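{- Let $[\beta_{n,k}]_{n\ge1,k\ge0}$ be defined by $\beta_{1,0}=1$, $\beta_{n,k}=0$ unless $0\le k\le n-1$, and for $n\ge1$, $k\ge0$, $$\beta_{n+1,k}=(3n-k-1)\beta_{n,k}+n\beta_{n,k-1}-(k+1)\beta_{n,k+1},$$ and let $\beta_n(q)=\sum_{k=0}^{n-1}\beta_{n,k}q^k$. Then: (i) for each $n\ge1$, every entry of the row $\{\beta_{n,k}\}_{k=0}^{n-1}$ is positive; (ii) for each $n\ge1$, the row $\{\beta_{n,k}\}_{k=0}^{n-1}$ is log-concave; (iii) the sequence of polynomials $(f_n(q))_{n\ge0}$ with $f_n(q)=\beta_{n+1}(q)$ is strongly $q$-log-convex.
   Context: These numbers arise from the Lambert function $W$ ($We^W=x$): $\frac{d^nW}{dx^n}=\frac{e^{ -nW}p_n(W)}{(1+W)^{2n-1}}$ with $p_n(x)=(-1)^{n-1}\sum_{k=0}^{n-1}\beta_{n,k}x^k$. A sequence of positive numbers $\{a_k\}$ is log-concave if $a_ka_{k+2}\le a_{k+1}^2$ for all $k$. A sequence of real polynomials $(f_n(q))_{n\ge0}$ is strongly $q$-log-convex if $f_{n+1}(q)f_{m-1}(q)-f_n(q)f_m(q)$ is a polynomial in $q$ with nonnegative coefficients for all $n\ge m\ge1$. -}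

module Defs where

open import Data.Nat using (ℕ; zero; suc; _<_; _≤_; _<?_) renaming (_*_ to _*ℕ_; _∸_ to _∸ℕ_; _+_ to _+ℕ_)
open import Data.Integer using (ℤ; +_; _+_; _-_; _*_; 0ℤ; 1ℤ) renaming (_≤_ to _≤ℤ_)
open import Relation.Nullary using (yes; no)

-- β n k  for the triangle [β_{n,k}], n ≥ 1, k ≥ 0.
-- β 0 k is an unused dummy value (0).
-- β 1 0 = 1, β 1 k = 0 for k ≥ 1, and for n ≥ 1:
--   β (n+1) k = (3n - k - 1) β n k + n β n (k-1) - (k+1) β n (k+1)
-- with β n (-1) = 0.  Computed in ℤ since the recurrence has subtraction.
-- (The recurrence automatically yields β n k = 0 for k ≥ n.)
β : ℕ → ℕ → ℤ
βprev : ℕ → ℕ → ℤ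
β zero k = 0ℤ
β (suc zero) zero = 1ℤ
β (suc zero) (suc k) = 0ℤ
β (suc (suc n)) k =
  ((+ (3 *ℕ suc n)) - (+ k) - 1ℤ) * β (suc n) k
  + (+ suc n) * βprev (suc n) k
  - (+ suc k) * β (suc n) (suc k)
βprev n zero = 0ℤ
βprev n (suc k) = β n k

-- Polynomials in q with integer coefficients, represented by their
-- coefficient function: p j = coefficient of q^j (finitely supported in use).
Poly : Set
Poly = ℕ → ℤ

βpoly : ℕ → Poly
βpoly n k with k <? n
... | yes _ = β n k
... | no _ = 0ℤ

sumTo : ℕ → (ℕ → ℤ) → ℤ
sumTo zero f = f zero
sumTo (suc j) f = sumTo j f + f (suc j)

_·_ : Poly → Poly → Poly
(p · r) j = sumTo j (λ i → p i * r (j ∸ℕ i))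

_−_ : Poly → Poly → Poly
(p − r) j = p j - r j

NonnegCoeffs : Poly → Set
NonnegCoeffs p = ∀ j → + 0 ≤ℤ p j

StronglyQLogConvex : (ℕ → Poly) → Set
StronglyQLogConvex f =
  ∀ n m → 1 ≤ m → m ≤ n → NonnegCoeffs ((f (suc n) · f (m ∸ℕ 1)) − (f n · f m))

LogConcaveRow : ℕ → (ℕ → ℤ) → Set
LogConcaveRow len a = ∀ k → k +ℕ 2 < len → a k * a (k +ℕ 2) ≤ℤ a (suc k) * a (suc k)

-- Writing β_{m+1}(q) = Σ_i ρ(m,i) (1+q)^(m-i), the recurrence for β becomes the
-- positive recurrence ρ(a+1,k) = (a+1) ρ(a,k) + (a+k) ρ(a,k-1), so ρ(m,i) > 0 for
-- i ≤ m and positivity of β follows.  The weighted rows (m-i)! ρ(m,i) satisfy a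
-- recurrence to which Kurtz's criterion applies, so they are log-concave; hence the
-- ratios ρ(m,i+1)/ρ(m,i) decrease and ρ is TP₂.  Log-concavity of the row β_{m+1} follows
-- from a Binet–Cauchy identity for β_{m+1}(q) and its derivative, each term of which is
-- a product of two minors of the same sign.  Finally, by Vandermonde, a product of two
-- such expansions in powers of 1+q is the expansion of the convolution of the ρ-rows,
-- and the coefficients of ρ(n+1)·ρ(m) - ρ(n)·ρ(m+1) are nonnegative for m < n by the
-- TP₂ property, after pairing the terms i and J - i of each convolution.

module Submission where

open import Defs
open import Data.Integer
  using (ℤ; +_; -[1+_]; _+_; _-_; _*_; -_; 0ℤ; 1ℤ; +≤+; +<+)
  renaming (_≤_ to _≤ℤ_; _<_ to _<ℤ_)
import Data.Integer.Properties as ℤ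
open import Data.Integer.Tactic.RingSolver using (solve-∀)
open import Data.Nat
  using (ℕ; zero; suc; _∸_; _<_; _≤_; z≤n; s≤s; _!; _<?_; _≤?_)
  renaming (_+_ to _+ℕ_; _*_ to _*ℕ_)
import Data.Nat.Properties as ℕ
open import Data.Nat.Combinatorics using (_C_; nC1≡n; k>n⇒nCk≡0; nCk+nC[k+1]≡[n+1]C[k+1])
import Data.Nat.Tactic.RingSolver as ℕSolver
open import Data.Product using (_×_; _,_)
open import Relation.Binary.Definitions using (tri<; tri≈; tri>)
open import Relation.Binary.PropositionalEquality
open import Relation.Nullary using (yes; no)

0≤i+j : ∀ {i j} → 0ℤ ≤ℤ i → 0ℤ ≤ℤ j → 0ℤ ≤ℤ i + j
0≤i+j = ℤ.+-mono-≤

0≤i*j : ∀ {i j} → 0ℤ ≤ℤ i → 0ℤ ≤ℤ j → 0ℤ ≤ℤ i * j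
0≤i*j (+≤+ {n = m} _) (+≤+ {n = n} _) = subst (0ℤ ≤ℤ_) (ℤ.pos-* m n) (+≤+ z≤n)

0<i*j : ∀ {i j} → 0ℤ <ℤ i → 0ℤ <ℤ j → 0ℤ <ℤ i * j
0<i*j {+ suc m} {+ suc n} _ _ = subst (0ℤ <ℤ_) (ℤ.pos-* (suc m) (suc n)) (+<+ (s≤s z≤n))
0<i*j {+ zero} (+<+ ()) _
0<i*j {+ suc m} {+ zero} _ (+<+ ())

0≤i*i : ∀ i → 0ℤ ≤ℤ i * i
0≤i*i (+ n) = 0≤i*j {+ n} {+ n} (+≤+ z≤n) (+≤+ z≤n)
0≤i*i -[1+ n ] = +≤+ z≤n

0≤+n : ∀ n → 0ℤ ≤ℤ + n
0≤+n n = +≤+ z≤n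

0<1+n : ∀ n → 0ℤ <ℤ + suc n
0<1+n n = +<+ (s≤s z≤n)

*-cancelˡ-≤-0< : ∀ {c a b} → 0ℤ <ℤ c → c * a ≤ℤ c * b → a ≤ℤ b
*-cancelˡ-≤-0< {+ suc n} {a} {b} _ = ℤ.*-cancelˡ-≤-pos a b (+ suc n)
*-cancelˡ-≤-0< {+ zero} (+<+ ())

*-mono-≤-0≤ : ∀ {a b c d} → 0ℤ ≤ℤ a → a ≤ℤ b → 0ℤ ≤ℤ c → c ≤ℤ d → a * c ≤ℤ b * d
*-mono-≤-0≤ {a} {b} {c} {d} 0≤a a≤b 0≤c c≤d = ℤ.0≤i-j⇒j≤i (subst (0ℤ ≤ℤ_) (expand a b c d)
    (0≤i+j (0≤i*j (ℤ.≤-trans 0≤a a≤b) (ℤ.i≤j⇒0≤j-i c≤d)) (0≤i*j 0≤c (ℤ.i≤j⇒0≤j-i a≤b))))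
  where expand : ∀ a b c d → b * (d - c) + c * (b - a) ≡ b * d - a * c
        expand = solve-∀

x≤y+x : ∀ {x y} → 0ℤ ≤ℤ y → x ≤ℤ y + x
x≤y+x {x} {y} 0≤y = subst (_≤ℤ y + x) (ℤ.+-identityˡ x) (ℤ.+-monoˡ-≤ x 0≤y)

x≡0⇒x≤y : ∀ {x} y → 0ℤ ≤ℤ y → x ≡ 0ℤ → x ≤ℤ y
x≡0⇒x≤y y 0≤y refl = 0≤y

0≤2*i⇒0≤i : ∀ {i} → 0ℤ ≤ℤ + 2 * i → 0ℤ ≤ℤ i
0≤2*i⇒0≤i {i} h = *-cancelˡ-≤-0< (0<1+n 1) (subst (_≤ℤ + 2 * i) (sym (ℤ.*-zeroʳ (+ 2))) h)

+[1+n]≡1+n : ∀ n → + suc n ≡ 1ℤ + + n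
+[1+n]≡1+n n = ℤ.pos-+ 1 n

+[m∸n]≡m-n : ∀ {m n} → n ≤ m → + (m ∸ n) ≡ + m - + n
+[m∸n]≡m-n {m} {n} n≤m = trans (sym (ℤ.⊖-≥ n≤m)) (sym (ℤ.[+m]-[+n]≡m⊖n m n))

sumTo-cong : ∀ j {f g : ℕ → ℤ} → (∀ i → i ≤ j → f i ≡ g i) → sumTo j f ≡ sumTo j g
sumTo-cong zero h = h 0 z≤n
sumTo-cong (suc j) h = cong₂ _+_ (sumTo-cong j (λ i i≤j → h i (ℕ.m≤n⇒m≤1+n i≤j))) (h (suc j) ℕ.≤-refl)

sumTo-+ : ∀ j (f g : ℕ → ℤ) → sumTo j (λ i → f i + g i) ≡ sumTo j f + sumTo j g
sumTo-+ zero f g = refl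
sumTo-+ (suc j) f g = trans (cong (_+ (f (suc j) + g (suc j))) (sumTo-+ j f g))
                            (swap (sumTo j f) (sumTo j g) (f (suc j)) (g (suc j)))
  where swap : ∀ a b c d → (a + b) + (c + d) ≡ (a + c) + (b + d)
        swap = solve-∀

sumTo-*ˡ : ∀ j (c : ℤ) (f : ℕ → ℤ) → sumTo j (λ i → c * f i) ≡ c * sumTo j f
sumTo-*ˡ zero c f = refl
sumTo-*ˡ (suc j) c f = trans (cong (_+ (c * f (suc j))) (sumTo-*ˡ j c f))
                             (sym (ℤ.*-distribˡ-+ c (sumTo j f) (f (suc j))))

sumTo-*ʳ : ∀ j (c : ℤ) (f : ℕ → ℤ) → sumTo j (λ i → f i * c) ≡ sumTo j f * c
sumTo-*ʳ j c f = trans (sumTo-cong j (λ i _ → ℤ.*-comm (f i) c))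
                       (trans (sumTo-*ˡ j c f) (ℤ.*-comm c (sumTo j f)))

sumTo-neg : ∀ j (f : ℕ → ℤ) → sumTo j (λ i → - f i) ≡ - sumTo j f
sumTo-neg zero f = refl
sumTo-neg (suc j) f = trans (cong (_+ (- f (suc j))) (sumTo-neg j f))
                            (sym (ℤ.neg-distrib-+ (sumTo j f) (f (suc j))))

sumTo-- : ∀ j (f g : ℕ → ℤ) → sumTo j (λ i → f i - g i) ≡ sumTo j f - sumTo j g
sumTo-- j f g = trans (sumTo-+ j f (λ i → - g i)) (cong (_+_ (sumTo j f)) (sumTo-neg j g))

sumTo-0 : ∀ j (f : ℕ → ℤ) → (∀ i → i ≤ j → f i ≡ 0ℤ) → sumTo j f ≡ 0ℤ
sumTo-0 j f h = trans (sumTo-cong j h) (sumTo-const0 j)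
  where sumTo-const0 : ∀ j → sumTo j (λ _ → 0ℤ) ≡ 0ℤ
        sumTo-const0 zero = refl
        sumTo-const0 (suc j) = cong (_+ 0ℤ) (sumTo-const0 j)

sumTo-nonNeg : ∀ j (f : ℕ → ℤ) → (∀ i → i ≤ j → 0ℤ ≤ℤ f i) → 0ℤ ≤ℤ sumTo j f
sumTo-nonNeg zero f h = h 0 z≤n
sumTo-nonNeg (suc j) f h = 0≤i+j (sumTo-nonNeg j f (λ i i≤j → h i (ℕ.m≤n⇒m≤1+n i≤j))) (h (suc j) ℕ.≤-refl)

f0≤sumTo : ∀ j (f : ℕ → ℤ) → (∀ i → 0ℤ ≤ℤ f i) → f 0 ≤ℤ sumTo j f
f0≤sumTo zero f h = ℤ.≤-refl
f0≤sumTo (suc j) f h = ℤ.≤-trans (f0≤sumTo j f h)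
  (subst (_≤ℤ sumTo j f + f (suc j)) (ℤ.+-identityʳ (sumTo j f)) (ℤ.+-monoʳ-≤ (sumTo j f) (h (suc j))))

sumTo-head : ∀ j (f : ℕ → ℤ) → sumTo (suc j) f ≡ f 0 + sumTo j (λ i → f (suc i))
sumTo-head zero f = refl
sumTo-head (suc j) f = trans (cong (_+ f (suc (suc j))) (sumTo-head j f))
                             (ℤ.+-assoc (f 0) (sumTo j (λ i → f (suc i))) (f (suc (suc j))))

1+n∸m≡1+[n∸m] : ∀ {m n} → m ≤ n → suc n ∸ m ≡ suc (n ∸ m)
1+n∸m≡1+[n∸m] = ℕ.+-∸-assoc 1

sumTo-reverse : ∀ j (f : ℕ → ℤ) → sumTo j f ≡ sumTo j (λ i → f (j ∸ i))
sumTo-reverse zero f = refl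
sumTo-reverse (suc j) f = begin
    sumTo (suc j) f
  ≡⟨ sumTo-head j f ⟩
    f 0 + sumTo j (λ i → f (suc i))
  ≡⟨ cong (_+_ (f 0)) (sumTo-reverse j (λ i → f (suc i))) ⟩
    f 0 + sumTo j (λ i → f (suc (j ∸ i)))
  ≡⟨ ℤ.+-comm (f 0) _ ⟩
    sumTo j (λ i → f (suc (j ∸ i))) + f 0
  ≡⟨ cong₂ _+_ (sumTo-cong j (λ i i≤j → cong f (sym (1+n∸m≡1+[n∸m] i≤j))))
               (cong f (sym (ℕ.n∸n≡0 (suc j)))) ⟩
    sumTo (suc j) (λ i → f (suc j ∸ i))
  ∎
  where open ≡-Reasoning

sumTo-extend : ∀ {M B} (f : ℕ → ℤ) → B ≤ M → (∀ i → B < i → f i ≡ 0ℤ) → sumTo M f ≡ sumTo B f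
sumTo-extend {M} {B} f B≤M h = trans (cong (λ t → sumTo t f) (sym (ℕ.m∸n+n≡m B≤M))) (go (M ∸ B))
  where
  go : ∀ d → sumTo (d +ℕ B) f ≡ sumTo B f
  go zero = refl
  go (suc d) = trans (cong₂ _+_ (go d) (h (suc (d +ℕ B)) (s≤s (ℕ.m≤n+m B d)))) (ℤ.+-identityʳ (sumTo B f))

sumTo-*-sumTo : ∀ A B (f g : ℕ → ℤ) → sumTo A f * sumTo B g ≡ sumTo A (λ p → sumTo B (λ q → f p * g q))
sumTo-*-sumTo A B f g = trans (sym (sumTo-*ʳ A (sumTo B g) f))
                              (sumTo-cong A (λ p _ → sym (sumTo-*ˡ B (f p) g)))

sumTo-comm : ∀ A B (F : ℕ → ℕ → ℤ) →
  sumTo A (λ p → sumTo B (λ q → F p q)) ≡ sumTo B (λ q → sumTo A (λ p → F p q))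
sumTo-comm zero B F = refl
sumTo-comm (suc A) B F = trans (cong (_+ sumTo B (F (suc A))) (sumTo-comm A B F))
                               (sym (sumTo-+ B (λ q → sumTo A (λ p → F p q)) (F (suc A))))

sumTo-triangle : ∀ N (G : ℕ → ℕ → ℤ) →
  sumTo N (λ u → sumTo u (λ i → G i (u ∸ i))) ≡ sumTo N (λ i → sumTo (N ∸ i) (G i))
sumTo-triangle zero G = refl
sumTo-triangle (suc N) G = begin
    sumTo N (λ u → sumTo u (λ i → G i (u ∸ i))) + sumTo (suc N) (λ i → G i (suc N ∸ i))
  ≡⟨ cong (_+ sumTo (suc N) (λ i → G i (suc N ∸ i))) (sumTo-triangle N G) ⟩
    sumTo N (λ i → sumTo (N ∸ i) (G i)) + (sumTo N (λ i → G i (suc N ∸ i)) + G (suc N) (N ∸ N))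
  ≡⟨ sym (ℤ.+-assoc (sumTo N (λ i → sumTo (N ∸ i) (G i))) _ _) ⟩
    (sumTo N (λ i → sumTo (N ∸ i) (G i)) + sumTo N (λ i → G i (suc N ∸ i))) + G (suc N) (N ∸ N)
  ≡⟨ cong₂ _+_ (trans (sym (sumTo-+ N _ _)) (sumTo-cong N extend-row))
               (trans (cong (G (suc N)) (ℕ.n∸n≡0 N)) (cong (λ t → sumTo t (G (suc N))) (sym (ℕ.n∸n≡0 N)))) ⟩
    sumTo (suc N) (λ i → sumTo (suc N ∸ i) (G i))
  ∎
  where
  open ≡-Reasoning
  extend-row : ∀ i → i ≤ N → sumTo (N ∸ i) (G i) + G i (suc N ∸ i) ≡ sumTo (suc N ∸ i) (G i)
  extend-row i i≤N rewrite 1+n∸m≡1+[n∸m] i≤N = refl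

nCk>0 : ∀ {n k} → k ≤ n → 0 < n C k
nCk>0 {n} {zero} _ = s≤s z≤n
nCk>0 {suc n} {suc k} (s≤s k≤n) =
  subst (0 <_) (nCk+nC[k+1]≡[n+1]C[k+1] n k) (ℕ.<-≤-trans (nCk>0 k≤n) (ℕ.m≤m+n (n C k) (n C suc k)))

[n+1]*nCk≡[k+1]*[n+1]C[k+1] : ∀ n k → suc n *ℕ (n C k) ≡ suc k *ℕ (suc n C suc k)
[n+1]*nCk≡[k+1]*[n+1]C[k+1] zero zero = refl
[n+1]*nCk≡[k+1]*[n+1]C[k+1] zero (suc k) =
  trans (cong (1 *ℕ_) (k>n⇒nCk≡0 {0} {suc k} (s≤s z≤n)))
        (sym (trans (cong (suc (suc k) *ℕ_) (k>n⇒nCk≡0 {1} {suc (suc k)} (s≤s (s≤s z≤n))))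
                    (ℕ.*-zeroʳ (suc (suc k)))))
[n+1]*nCk≡[k+1]*[n+1]C[k+1] (suc n) zero rewrite nC1≡n (suc (suc n)) = ℕ.*-comm (suc (suc n)) 1
[n+1]*nCk≡[k+1]*[n+1]C[k+1] (suc n) (suc k) = begin
    suc (suc n) *ℕ (suc n C suc k)
  ≡⟨ cong (suc (suc n) *ℕ_) (sym pascal) ⟩
    suc (suc n) *ℕ (x +ℕ y)
  ≡⟨ split n x y ⟩
    (suc n *ℕ x +ℕ (x +ℕ y)) +ℕ suc n *ℕ y
  ≡⟨ cong₂ (λ a b → (a +ℕ (x +ℕ y)) +ℕ b)
           ([n+1]*nCk≡[k+1]*[n+1]C[k+1] n k) ([n+1]*nCk≡[k+1]*[n+1]C[k+1] n (suc k)) ⟩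
    (suc k *ℕ (suc n C suc k) +ℕ (x +ℕ y)) +ℕ suc (suc k) *ℕ z
  ≡⟨ cong (λ a → (suc k *ℕ a +ℕ (x +ℕ y)) +ℕ suc (suc k) *ℕ z) (sym pascal) ⟩
    (suc k *ℕ (x +ℕ y) +ℕ (x +ℕ y)) +ℕ suc (suc k) *ℕ z
  ≡⟨ merge k (x +ℕ y) z ⟩
    suc (suc k) *ℕ ((x +ℕ y) +ℕ z)
  ≡⟨ cong (λ a → suc (suc k) *ℕ (a +ℕ z)) pascal ⟩
    suc (suc k) *ℕ (suc n C suc k +ℕ z)
  ≡⟨ cong (suc (suc k) *ℕ_) (nCk+nC[k+1]≡[n+1]C[k+1] (suc n) (suc k)) ⟩
    suc (suc k) *ℕ (suc (suc n) C suc (suc k))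
  ∎
  where
  open ≡-Reasoning
  x = n C k
  y = n C suc k
  z = suc n C suc (suc k)
  pascal : x +ℕ y ≡ suc n C suc k
  pascal = nCk+nC[k+1]≡[n+1]C[k+1] n k
  split : ∀ n x y → suc (suc n) *ℕ (x +ℕ y) ≡ (suc n *ℕ x +ℕ (x +ℕ y)) +ℕ suc n *ℕ y
  split = ℕSolver.solve-∀
  merge : ∀ k s z → (suc k *ℕ s +ℕ s) +ℕ suc (suc k) *ℕ z ≡ suc (suc k) *ℕ (s +ℕ z)
  merge = ℕSolver.solve-∀

[k+1]*nC[k+1]+k*nCk≡n*nCk : ∀ n k → suc k *ℕ (n C suc k) +ℕ k *ℕ (n C k) ≡ n *ℕ (n C k)
[k+1]*nC[k+1]+k*nCk≡n*nCk zero zero = refl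
[k+1]*nC[k+1]+k*nCk≡n*nCk zero (suc k)
  rewrite k>n⇒nCk≡0 {0} {suc k} (s≤s z≤n) | k>n⇒nCk≡0 {0} {suc (suc k)} (s≤s z≤n)
        | ℕ.*-zeroʳ (suc (suc k)) = refl
[k+1]*nC[k+1]+k*nCk≡n*nCk (suc n) zero rewrite nC1≡n (suc n) =
  trans (ℕ.+-identityʳ _) (trans (ℕ.+-identityʳ _) (sym (ℕ.*-identityʳ (suc n))))
[k+1]*nC[k+1]+k*nCk≡n*nCk (suc n) (suc k) = begin
    suc (suc k) *ℕ (suc n C suc (suc k)) +ℕ suc k *ℕ (suc n C suc k)
  ≡⟨ sym (cong₂ _+ℕ_ ([n+1]*nCk≡[k+1]*[n+1]C[k+1] n (suc k)) ([n+1]*nCk≡[k+1]*[n+1]C[k+1] n k)) ⟩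
    suc n *ℕ (n C suc k) +ℕ suc n *ℕ (n C k)
  ≡⟨ sym (ℕ.*-distribˡ-+ (suc n) (n C suc k) (n C k)) ⟩
    suc n *ℕ (n C suc k +ℕ n C k)
  ≡⟨ cong (suc n *ℕ_) (trans (ℕ.+-comm (n C suc k) (n C k)) (nCk+nC[k+1]≡[n+1]C[k+1] n k)) ⟩
    suc n *ℕ (suc n C suc k)
  ∎
  where open ≡-Reasoning

Cℤ : ℕ → ℕ → ℤ
Cℤ n k = + (n C k)

Cprevℤ : ℕ → ℕ → ℤ
Cprevℤ n zero = 0ℤ
Cprevℤ n (suc k) = Cℤ n k

Cℤ-pascal : ∀ n k → Cℤ (suc n) k ≡ Cprevℤ n k + Cℤ n k
Cℤ-pascal n zero = refl
Cℤ-pascal n (suc k) = trans (cong +_ (sym (nCk+nC[k+1]≡[n+1]C[k+1] n k))) (ℤ.pos-+ (n C k) (n C suc k))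

Cℤ-absorption : ∀ n k → + suc n * Cℤ n k ≡ + suc k * Cℤ (suc n) (suc k)
Cℤ-absorption n k = trans (sym (ℤ.pos-* (suc n) (n C k)))
  (trans (cong +_ ([n+1]*nCk≡[k+1]*[n+1]C[k+1] n k)) (ℤ.pos-* (suc k) (suc n C suc k)))

Cℤ-absorption-∸ : ∀ {m i} k → i ≤ m →
  (1ℤ + + k) * Cℤ (m ∸ i) (suc k) + + k * Cℤ (m ∸ i) k ≡ (+ m - + i) * Cℤ (m ∸ i) k
Cℤ-absorption-∸ {m} {i} k i≤m = begin
    (1ℤ + + k) * Cℤ j (suc k) + + k * Cℤ j k
  ≡⟨ cong (λ c → c * Cℤ j (suc k) + + k * Cℤ j k) (sym (+[1+n]≡1+n k)) ⟩
    + suc k * Cℤ j (suc k) + + k * Cℤ j k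
  ≡⟨ sym (cong₂ _+_ (ℤ.pos-* (suc k) (j C suc k)) (ℤ.pos-* k (j C k))) ⟩
    + (suc k *ℕ (j C suc k)) + + (k *ℕ (j C k))
  ≡⟨ sym (ℤ.pos-+ (suc k *ℕ (j C suc k)) (k *ℕ (j C k))) ⟩
    + (suc k *ℕ (j C suc k) +ℕ k *ℕ (j C k))
  ≡⟨ cong +_ ([k+1]*nC[k+1]+k*nCk≡n*nCk j k) ⟩
    + (j *ℕ (j C k))
  ≡⟨ ℤ.pos-* j (j C k) ⟩
    + j * Cℤ j k
  ≡⟨ cong (_* Cℤ j k) (+[m∸n]≡m-n i≤m) ⟩
    (+ m - + i) * Cℤ j k
  ∎
  where
  open ≡-Reasoning
  j = m ∸ i

vandermonde : ∀ a b J → sumTo J (λ j → Cℤ a j * Cℤ b (J ∸ j)) ≡ Cℤ (a +ℕ b) J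
vandermonde-prev : ∀ a b J → sumTo J (λ j → Cprevℤ a j * Cℤ b (J ∸ j)) ≡ Cprevℤ (a +ℕ b) J
vandermonde zero b zero = ℤ.*-identityˡ (Cℤ b 0)
vandermonde zero b (suc J) = begin
    sumTo (suc J) (λ j → Cℤ 0 j * Cℤ b (suc J ∸ j))
  ≡⟨ sumTo-head J _ ⟩
    1ℤ * Cℤ b (suc J) + sumTo J (λ j → Cℤ 0 (suc j) * Cℤ b (J ∸ j))
  ≡⟨ cong₂ _+_ (ℤ.*-identityˡ (Cℤ b (suc J)))
               (sumTo-0 J _ (λ j _ → cong (_* Cℤ b (J ∸ j)) (cong +_ (k>n⇒nCk≡0 {0} {suc j} (s≤s z≤n))))) ⟩
    Cℤ b (suc J) + 0ℤ
  ≡⟨ ℤ.+-identityʳ _ ⟩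
    Cℤ b (suc J)
  ∎
  where open ≡-Reasoning
vandermonde (suc a) b J = begin
    sumTo J (λ j → Cℤ (suc a) j * Cℤ b (J ∸ j))
  ≡⟨ sumTo-cong J (λ j _ → trans (cong (_* Cℤ b (J ∸ j)) (Cℤ-pascal a j))
                                 (ℤ.*-distribʳ-+ (Cℤ b (J ∸ j)) (Cprevℤ a j) (Cℤ a j))) ⟩
    sumTo J (λ j → Cprevℤ a j * Cℤ b (J ∸ j) + Cℤ a j * Cℤ b (J ∸ j))
  ≡⟨ sumTo-+ J _ _ ⟩
    sumTo J (λ j → Cprevℤ a j * Cℤ b (J ∸ j)) + sumTo J (λ j → Cℤ a j * Cℤ b (J ∸ j))
  ≡⟨ cong₂ _+_ (vandermonde-prev a b J) (vandermonde a b J) ⟩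
    Cprevℤ (a +ℕ b) J + Cℤ (a +ℕ b) J
  ≡⟨ sym (Cℤ-pascal (a +ℕ b) J) ⟩
    Cℤ (suc a +ℕ b) J
  ∎
  where open ≡-Reasoning
vandermonde-prev a b zero = ℤ.*-zeroˡ (Cℤ b 0)
vandermonde-prev a b (suc J) = begin
    sumTo (suc J) (λ j → Cprevℤ a j * Cℤ b (suc J ∸ j))
  ≡⟨ sumTo-head J _ ⟩
    0ℤ * Cℤ b (suc J) + sumTo J (λ j → Cℤ a j * Cℤ b (J ∸ j))
  ≡⟨ cong₂ _+_ (ℤ.*-zeroˡ (Cℤ b (suc J))) (vandermonde a b J) ⟩
    0ℤ + Cℤ (a +ℕ b) J
  ≡⟨ ℤ.+-identityˡ _ ⟩
    Cℤ (a +ℕ b) J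
  ∎
  where open ≡-Reasoning

-- The triangle ρ, with β_{m+1}(q) = Σ_i ρ m i (1+q)^(m-i) (β≡binomialTransform)

ρ : ℕ → ℕ → ℤ
ρ zero zero = 1ℤ
ρ zero (suc k) = 0ℤ
ρ (suc a) zero = (+ a + 1ℤ) * ρ a zero
ρ (suc a) (suc k) = (+ a + 1ℤ) * ρ a (suc k) + (+ a + + k + 1ℤ) * ρ a k

ρshift : ℕ → ℕ → ℤ
ρshift a zero = 0ℤ
ρshift a (suc k) = (+ a + + k + 1ℤ) * ρ a k

ρ-suc : ∀ a k → ρ (suc a) k ≡ (+ a + 1ℤ) * ρ a k + ρshift a k
ρ-suc a zero = sym (ℤ.+-identityʳ _)
ρ-suc a (suc k) = refl

0≤a+1 : ∀ a → 0ℤ ≤ℤ + a + 1ℤ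
0≤a+1 a = 0≤i+j (0≤+n a) (0≤+n 1)

0≤a+k+1 : ∀ a k → 0ℤ ≤ℤ + a + + k + 1ℤ
0≤a+k+1 a k = 0≤i+j (0≤i+j (0≤+n a) (0≤+n k)) (0≤+n 1)

0<a+1 : ∀ a → 0ℤ <ℤ + a + 1ℤ
0<a+1 a = subst (0ℤ <ℤ_) (ℤ.pos-+ a 1) (+<+ (ℕ.m≤n+m 1 a))

0<a+k+1 : ∀ a k → 0ℤ <ℤ + a + + k + 1ℤ
0<a+k+1 a k = subst (0ℤ <ℤ_) (trans (sym (ℤ.pos-+ (a +ℕ k) 1)) (cong (_+ 1ℤ) (ℤ.pos-+ a k)))
  (+<+ (ℕ.m≤n+m 1 (a +ℕ k)))

ρ-vanish : ∀ a k → a < k → ρ a k ≡ 0ℤ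
ρ-vanish zero (suc k) _ = refl
ρ-vanish (suc a) (suc k) (s≤s a<k)
  rewrite ρ-vanish a (suc k) (ℕ.m≤n⇒m≤1+n a<k) | ρ-vanish a k a<k
        | ℤ.*-zeroʳ (+ a + 1ℤ) | ℤ.*-zeroʳ (+ a + + k + 1ℤ) = refl

ρ-nonNeg : ∀ a k → 0ℤ ≤ℤ ρ a k
ρ-nonNeg zero zero = +≤+ z≤n
ρ-nonNeg zero (suc k) = +≤+ z≤n
ρ-nonNeg (suc a) zero = 0≤i*j (0≤a+1 a) (ρ-nonNeg a zero)
ρ-nonNeg (suc a) (suc k) = 0≤i+j (0≤i*j (0≤a+1 a) (ρ-nonNeg a (suc k))) (0≤i*j (0≤a+k+1 a k) (ρ-nonNeg a k))

ρ-pos : ∀ a k → k ≤ a → 0ℤ <ℤ ρ a k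
ρ-pos zero zero _ = +<+ (s≤s z≤n)
ρ-pos (suc a) zero _ = 0<i*j (0<a+1 a) (ρ-pos a zero z≤n)
ρ-pos (suc a) (suc k) (s≤s k≤a) =
  ℤ.<-≤-trans (0<i*j (0<a+k+1 a k) (ρ-pos a k k≤a)) (x≤y+x (0≤i*j (0≤a+1 a) (ρ-nonNeg a (suc k))))

LogConcave : (ℕ → ℤ) → Set
LogConcave x = ∀ k → x k * x (suc (suc k)) ≤ℤ x (suc k) * x (suc k)

-- Kurtz's inequality: if y_j = P_j x_j + B_j x_(j-1), where P and B vary like
-- quadratics (the three identities), then the log-concavity defect of y is a
-- nonnegative combination of those of x plus the square (Q x₂ - R x₁)².
kurtz : ∀ (x₀ x₁ x₂ x₃ P₀ P₁ P₂ B₀ B₁ B₂ Q R : ℤ)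
  → P₀ * P₂ ≡ P₁ * P₁ - Q * Q
  → B₀ * B₂ ≡ B₁ * B₁ - R * R
  → P₀ * B₂ + P₂ * B₀ ≡ (P₁ * B₁ + Q * R) + (P₁ * B₁ + Q * R)
  → 0ℤ ≤ℤ P₁ * P₁ - Q * Q → 0ℤ ≤ℤ B₁ * B₁ - R * R → 0ℤ ≤ℤ P₂ * B₀
  → x₀ * x₂ ≤ℤ x₁ * x₁ → x₁ * x₃ ≤ℤ x₂ * x₂ → x₀ * x₃ ≤ℤ x₁ * x₂
  → (P₀ * x₁ + B₀ * x₀) * (P₂ * x₃ + B₂ * x₂) ≤ℤ (P₁ * x₂ + B₁ * x₁) * (P₁ * x₂ + B₁ * x₁)
kurtz x₀ x₁ x₂ x₃ P₀ P₁ P₂ B₀ B₁ B₂ Q R hP hB hPB 0≤P 0≤B 0≤P₂B₀ lc₀ lc₁ lc₀₃ =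
  ℤ.0≤i-j⇒j≤i (subst (0ℤ ≤ℤ_) (sym defect≡T) 0≤T)
  where
  T : ℤ
  T = (P₁ * P₁ - Q * Q) * (x₂ * x₂ - x₁ * x₃) + (Q * x₂ - R * x₁) * (Q * x₂ - R * x₁)
      + (B₁ * B₁ - R * R) * (x₁ * x₁ - x₀ * x₂) + (P₂ * B₀) * (x₁ * x₂ - x₀ * x₃)
  0≤T : 0ℤ ≤ℤ T
  0≤T = 0≤i+j (0≤i+j (0≤i+j (0≤i*j 0≤P (ℤ.i≤j⇒0≤j-i lc₁)) (0≤i*i (Q * x₂ - R * x₁)))
                      (0≤i*j 0≤B (ℤ.i≤j⇒0≤j-i lc₀)))
              (0≤i*j 0≤P₂B₀ (ℤ.i≤j⇒0≤j-i lc₀₃))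
  identity : ∀ x₀ x₁ x₂ x₃ P₀ P₁ P₂ B₀ B₁ B₂ Q R →
     (P₁ * x₂ + B₁ * x₁) * (P₁ * x₂ + B₁ * x₁) - (P₀ * x₁ + B₀ * x₀) * (P₂ * x₃ + B₂ * x₂)
     ≡ ((P₁ * P₁ - Q * Q) * (x₂ * x₂ - x₁ * x₃) + (Q * x₂ - R * x₁) * (Q * x₂ - R * x₁)
      + (B₁ * B₁ - R * R) * (x₁ * x₁ - x₀ * x₂) + (P₂ * B₀) * (x₁ * x₂ - x₀ * x₃))
      + ((P₁ * P₁ - Q * Q) - P₀ * P₂) * (x₁ * x₃) + ((B₁ * B₁ - R * R) - B₀ * B₂) * (x₀ * x₂)
      + (((P₁ * B₁ + Q * R) + (P₁ * B₁ + Q * R)) - (P₀ * B₂ + P₂ * B₀)) * (x₁ * x₂)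
  identity = solve-∀
  v-u≡0 : ∀ {u v : ℤ} → u ≡ v → v - u ≡ 0ℤ
  v-u≡0 {u} refl = ℤ.+-inverseʳ u
  drop-zeros : ∀ T a b c → T + 0ℤ * a + 0ℤ * b + 0ℤ * c ≡ T
  drop-zeros = solve-∀
  defect≡T : (P₁ * x₂ + B₁ * x₁) * (P₁ * x₂ + B₁ * x₁) - (P₀ * x₁ + B₀ * x₀) * (P₂ * x₃ + B₂ * x₂) ≡ T
  defect≡T = trans (identity x₀ x₁ x₂ x₃ P₀ P₁ P₂ B₀ B₁ B₂ Q R)
    (trans (cong₂ (λ a b → T + a * (x₁ * x₃) + b * (x₀ * x₂) + c * (x₁ * x₂)) (v-u≡0 hP) (v-u≡0 hB))
    (trans (cong (λ c → T + 0ℤ * (x₁ * x₃) + 0ℤ * (x₀ * x₂) + c * (x₁ * x₂)) (v-u≡0 hPB))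
           (drop-zeros T (x₁ * x₃) (x₀ * x₂) (x₁ * x₂))))
    where c = ((P₁ * B₁ + Q * R) + (P₁ * B₁ + Q * R)) - (P₀ * B₂ + P₂ * B₀)

logConcave-ratio : ∀ (x : ℕ → ℤ) L → (∀ i → 0ℤ ≤ℤ x i) → (∀ i → i ≤ L → 0ℤ <ℤ x i)
  → (∀ i → L < i → x i ≡ 0ℤ) → LogConcave x
  → ∀ {p q} → p ≤ q → x p * x (suc q) ≤ℤ x (suc p) * x q
logConcave-ratio x L nonNeg pos vanish lc {p} {q} p≤q =
  subst (λ t → x p * x (suc t) ≤ℤ x (suc p) * x t) (ℕ.m∸n+n≡m p≤q) (from-gap (q ∸ p))
  where
  from-gap : ∀ d → x p * x (suc (d +ℕ p)) ≤ℤ x (suc p) * x (d +ℕ p)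
  from-gap zero = ℤ.≤-reflexive (ℤ.*-comm (x p) (x (suc p)))
  from-gap (suc d) with suc (suc (d +ℕ p)) ≤? L
  ... | no r+1≰L = x≡0⇒x≤y _ (0≤i*j (nonNeg (suc p)) (nonNeg (suc (d +ℕ p))))
        (trans (cong (x p *_) (vanish _ (ℕ.≰⇒> r+1≰L))) (ℤ.*-zeroʳ (x p)))
  ... | yes r+1≤L = *-cancelˡ-≤-0< 0<xrxr+1
        (subst₂ _≤ℤ_ (regroupˡ (x p) (x r) (x (suc r)) (x (suc (suc r)))) (regroupʳ (x (suc p)) (x r) (x (suc r)))
          (*-mono-≤-0≤ (0≤i*j (nonNeg p) (nonNeg (suc r))) (from-gap d)
                       (0≤i*j (nonNeg r) (nonNeg (suc (suc r)))) (lc r)))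
    where
    r = d +ℕ p
    0<xrxr+1 : 0ℤ <ℤ x r * x (suc r)
    0<xrxr+1 = 0<i*j (pos r (ℕ.≤-trans (ℕ.n≤1+n r) (ℕ.≤-trans (ℕ.n≤1+n (suc r)) r+1≤L)))
                     (pos (suc r) (ℕ.≤-trans (ℕ.n≤1+n (suc r)) r+1≤L))
    regroupˡ : ∀ a b c d → (a * c) * (b * d) ≡ (b * c) * (a * d)
    regroupˡ = solve-∀
    regroupʳ : ∀ a b c → (a * b) * (c * c) ≡ (b * c) * (a * c)
    regroupʳ = solve-∀

-- Ratio and TP₂ properties of ρ

factℤ : ℕ → ℤ
factℤ n = + (n !)

factℤ-suc : ∀ n → factℤ (suc n) ≡ + suc n * factℤ n
factℤ-suc n = ℤ.pos-* (suc n) (n !)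

factℤ-pos : ∀ n → 0ℤ <ℤ factℤ n
factℤ-pos zero = +<+ (s≤s z≤n)
factℤ-pos (suc n) = subst (0ℤ <ℤ_) (sym (factℤ-suc n)) (0<i*j (0<1+n n) (factℤ-pos n))

factℤ-∸ : ∀ {m i} → i < m → factℤ (m ∸ i) ≡ + (m ∸ i) * factℤ (m ∸ suc i)
factℤ-∸ {m} {i} i<m rewrite ℕ.+-∸-assoc 1 {m} {suc i} i<m = factℤ-suc (m ∸ suc i)

-- Weighting by (m - i)! turns the recurrence of ρ into one with the quadratic
-- coefficients required by Kurtz's inequality.
σ : ℕ → ℕ → ℤ
σ m i = factℤ (m ∸ i) * ρ m i

σprev : ℕ → ℕ → ℤ
σprev m zero = 0ℤ
σprev m (suc i) = σ m i

σ-nonNeg : ∀ m i → 0ℤ ≤ℤ σ m i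
σ-nonNeg m i = 0≤i*j (ℤ.<⇒≤ (factℤ-pos (m ∸ i))) (ρ-nonNeg m i)

σ-pos : ∀ m i → i ≤ m → 0ℤ <ℤ σ m i
σ-pos m i i≤m = 0<i*j (factℤ-pos (m ∸ i)) (ρ-pos m i i≤m)

σ-vanish : ∀ m i → m < i → σ m i ≡ 0ℤ
σ-vanish m i m<i rewrite ρ-vanish m i m<i = ℤ.*-zeroʳ (factℤ (m ∸ i))

σP : ℕ → ℕ → ℤ
σP m j = (+ m + 1ℤ) * ((+ m + 1ℤ) - + j)

σB : ℕ → ℕ → ℤ
σB m j = + m + + j

σ-rec : ∀ m j → σ (suc m) j ≡ σP m j * σ m j + σB m j * σprev m j
σ-rec m zero = begin
    factℤ (suc m) * ((+ m + 1ℤ) * ρ m 0)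
  ≡⟨ cong (_* ((+ m + 1ℤ) * ρ m 0))
          (trans (factℤ-suc m) (cong (_* factℤ m) (trans (+[1+n]≡1+n m) (ℤ.+-comm 1ℤ (+ m))))) ⟩
    ((+ m + 1ℤ) * factℤ m) * ((+ m + 1ℤ) * ρ m 0)
  ≡⟨ regroup (+ m) (factℤ m) (ρ m 0) ⟩
    ((+ m + 1ℤ) * ((+ m + 1ℤ) - 0ℤ)) * (factℤ m * ρ m 0) + (+ m + 0ℤ) * 0ℤ
  ∎
  where
  open ≡-Reasoning
  regroup : ∀ M F R → ((M + 1ℤ) * F) * ((M + 1ℤ) * R) ≡ ((M + 1ℤ) * ((M + 1ℤ) - 0ℤ)) * (F * R) + (M + 0ℤ) * 0ℤ
  regroup = solve-∀
σ-rec m (suc i) with i <? m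
... | yes i<m = begin
    factℤ (m ∸ i) * ((+ m + 1ℤ) * ρ m (suc i) + (+ m + + i + 1ℤ) * ρ m i)
  ≡⟨ cong (λ f → f * ((+ m + 1ℤ) * ρ m (suc i) + (+ m + + i + 1ℤ) * ρ m i)) fact≡ ⟩
    ((+ m - + i) * F) * ((+ m + 1ℤ) * ρ m (suc i) + (+ m + + i + 1ℤ) * ρ m i)
  ≡⟨ regroup (+ m) (+ i) F (ρ m (suc i)) (ρ m i) ⟩
    ((+ m + 1ℤ) * ((+ m + 1ℤ) - (1ℤ + + i))) * (F * ρ m (suc i)) + (+ m + (1ℤ + + i)) * (((+ m - + i) * F) * ρ m i)
  ≡⟨ cong₂ (λ a b → ((+ m + 1ℤ) * ((+ m + 1ℤ) - a)) * (F * ρ m (suc i)) + (+ m + a) * (b * ρ m i))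
           (sym (+[1+n]≡1+n i)) (sym fact≡) ⟩
    σP m (suc i) * σ m (suc i) + σB m (suc i) * σ m i
  ∎
  where
  open ≡-Reasoning
  F = factℤ (m ∸ suc i)
  fact≡ : factℤ (m ∸ i) ≡ (+ m - + i) * F
  fact≡ = trans (factℤ-∸ i<m) (cong (_* F) (+[m∸n]≡m-n (ℕ.<⇒≤ i<m)))
  regroup : ∀ M I F R₁ R₀ → ((M - I) * F) * ((M + 1ℤ) * R₁ + (M + I + 1ℤ) * R₀)
        ≡ ((M + 1ℤ) * ((M + 1ℤ) - (1ℤ + I))) * (F * R₁) + (M + (1ℤ + I)) * (((M - I) * F) * R₀)
  regroup = solve-∀
... | no i≮m rewrite ρ-vanish m (suc i) (s≤s (ℕ.≮⇒≥ i≮m)) | +[1+n]≡1+n i =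
  regroup (factℤ (m ∸ i)) (+ m + 1ℤ) (ρ m i) (σP m (suc i)) (factℤ (m ∸ suc i)) (+ m) (+ i)
  where
  regroup : ∀ F A R P G M I → F * (A * 0ℤ + (M + I + 1ℤ) * R) ≡ P * (G * 0ℤ) + (M + (1ℤ + I)) * (F * R)
  regroup = solve-∀

σP-quadratic : ∀ m k → σP m k * σP m (suc (suc k)) ≡ σP m (suc k) * σP m (suc k) - (+ m + 1ℤ) * (+ m + 1ℤ)
σP-quadratic m k rewrite +[1+n]≡1+n (suc k) | +[1+n]≡1+n k = identity (+ m) (+ k)
  where identity : ∀ M K → ((M + 1ℤ) * ((M + 1ℤ) - K)) * ((M + 1ℤ) * ((M + 1ℤ) - (1ℤ + (1ℤ + K))))
                         ≡ ((M + 1ℤ) * ((M + 1ℤ) - (1ℤ + K))) * ((M + 1ℤ) * ((M + 1ℤ) - (1ℤ + K))) - (M + 1ℤ) * (M + 1ℤ)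
        identity = solve-∀

σB-quadratic : ∀ m k → σB m k * σB m (suc (suc k)) ≡ σB m (suc k) * σB m (suc k) - 1ℤ * 1ℤ
σB-quadratic m k rewrite +[1+n]≡1+n (suc k) | +[1+n]≡1+n k = identity (+ m) (+ k)
  where identity : ∀ M K → (M + K) * (M + (1ℤ + (1ℤ + K))) ≡ (M + (1ℤ + K)) * (M + (1ℤ + K)) - 1ℤ * 1ℤ
        identity = solve-∀

σPB-quadratic : ∀ m k → σP m k * σB m (suc (suc k)) + σP m (suc (suc k)) * σB m k
  ≡ (σP m (suc k) * σB m (suc k) + (+ m + 1ℤ) * 1ℤ) + (σP m (suc k) * σB m (suc k) + (+ m + 1ℤ) * 1ℤ)
σPB-quadratic m k rewrite +[1+n]≡1+n (suc k) | +[1+n]≡1+n k = identity (+ m) (+ k)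
  where identity : ∀ M K → ((M + 1ℤ) * ((M + 1ℤ) - K)) * (M + (1ℤ + (1ℤ + K)))
                           + ((M + 1ℤ) * ((M + 1ℤ) - (1ℤ + (1ℤ + K)))) * (M + K)
                         ≡ (((M + 1ℤ) * ((M + 1ℤ) - (1ℤ + K))) * (M + (1ℤ + K)) + (M + 1ℤ) * 1ℤ)
                           + (((M + 1ℤ) * ((M + 1ℤ) - (1ℤ + K))) * (M + (1ℤ + K)) + (M + 1ℤ) * 1ℤ)
        identity = solve-∀

+[m∸[1+k]]≡m-[1+k] : ∀ {m k} → suc k ≤ m → + (m ∸ suc k) ≡ + m - (1ℤ + + k)
+[m∸[1+k]]≡m-[1+k] {m} {k} k<m = trans (+[m∸n]≡m-n k<m) (cong (_-_ (+ m)) (+[1+n]≡1+n k))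

σP-discriminant-nonNeg : ∀ m k → suc k ≤ m → 0ℤ ≤ℤ σP m (suc k) * σP m (suc k) - (+ m + 1ℤ) * (+ m + 1ℤ)
σP-discriminant-nonNeg m k k<m rewrite +[1+n]≡1+n k =
  subst (0ℤ ≤ℤ_) (trans (cong (λ d → ((+ m + 1ℤ) * (+ m + 1ℤ)) * (d * (d + + 2))) (+[m∸[1+k]]≡m-[1+k] k<m))
                        (identity (+ m) (+ k)))
        (0≤i*j (0≤i*i (+ m + 1ℤ)) (0≤i*j (0≤+n (m ∸ suc k)) (0≤i+j (0≤+n (m ∸ suc k)) (0≤+n 2))))
  where identity : ∀ M K → ((M + 1ℤ) * (M + 1ℤ)) * ((M - (1ℤ + K)) * ((M - (1ℤ + K)) + + 2))
                         ≡ ((M + 1ℤ) * ((M + 1ℤ) - (1ℤ + K))) * ((M + 1ℤ) * ((M + 1ℤ) - (1ℤ + K))) - (M + 1ℤ) * (M + 1ℤ)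
        identity = solve-∀

σB-discriminant-nonNeg : ∀ m k → 0ℤ ≤ℤ σB m (suc k) * σB m (suc k) - 1ℤ * 1ℤ
σB-discriminant-nonNeg m k rewrite +[1+n]≡1+n k =
  subst (0ℤ ≤ℤ_) (identity (+ m) (+ k)) (0≤i*j 0≤m+k (0≤i+j 0≤m+k (0≤+n 2)))
  where
  0≤m+k = 0≤i+j (0≤+n m) (0≤+n k)
  identity : ∀ M K → (M + K) * ((M + K) + + 2) ≡ (M + (1ℤ + K)) * (M + (1ℤ + K)) - 1ℤ * 1ℤ
  identity = solve-∀

σP*σB-nonNeg : ∀ m k → suc k ≤ m → 0ℤ ≤ℤ σP m (suc (suc k)) * σB m k
σP*σB-nonNeg m k k<m rewrite +[1+n]≡1+n (suc k) | +[1+n]≡1+n k =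
  subst (0ℤ ≤ℤ_) (trans (cong (λ d → ((+ m + 1ℤ) * d) * (+ m + + k)) (+[m∸[1+k]]≡m-[1+k] k<m)) (identity (+ m) (+ k)))
        (0≤i*j (0≤i*j (0≤a+1 m) (0≤+n (m ∸ suc k))) (0≤i+j (0≤+n m) (0≤+n k)))
  where identity : ∀ M K → ((M + 1ℤ) * (M - (1ℤ + K))) * (M + K)
                         ≡ ((M + 1ℤ) * ((M + 1ℤ) - (1ℤ + (1ℤ + K)))) * (M + K)
        identity = solve-∀

σ-logConcave : ∀ m → LogConcave (σ m)
σprev-σ-logConcave : ∀ m k → σprev m k * σ m (suc k) ≤ℤ σ m k * σ m k
σprev-σ-ratio : ∀ m k → σprev m k * σ m (suc (suc k)) ≤ℤ σ m k * σ m (suc k)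

σprev-σ-logConcave m zero = subst (_≤ℤ σ m 0 * σ m 0) (sym (ℤ.*-zeroˡ (σ m 1))) (0≤i*i (σ m 0))
σprev-σ-logConcave m (suc k) = σ-logConcave m k

σprev-σ-ratio m zero = subst (_≤ℤ σ m 0 * σ m 1) (sym (ℤ.*-zeroˡ (σ m 2))) (0≤i*j (σ-nonNeg m 0) (σ-nonNeg m 1))
σprev-σ-ratio m (suc k) =
  logConcave-ratio (σ m) m (σ-nonNeg m) (σ-pos m) (σ-vanish m) (σ-logConcave m) (ℕ.m≤n+m k 2)

σ-logConcave zero k rewrite σ-vanish zero (suc (suc k)) (s≤s z≤n) | ℤ.*-zeroʳ (σ zero k) = 0≤i*i (σ zero (suc k))
σ-logConcave (suc m) k with suc k ≤? m
... | no k+1≰m rewrite σ-vanish (suc m) (suc (suc k)) (s≤s (ℕ.≰⇒> k+1≰m)) | ℤ.*-zeroʳ (σ (suc m) k) =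
  0≤i*i (σ (suc m) (suc k))
... | yes k+1≤m = subst₂ _≤ℤ_ (sym (cong₂ _*_ (σ-rec m k) (σ-rec m (suc (suc k)))))
                               (sym (cong₂ _*_ (σ-rec m (suc k)) (σ-rec m (suc k))))
  (kurtz (σprev m k) (σ m k) (σ m (suc k)) (σ m (suc (suc k)))
         (σP m k) (σP m (suc k)) (σP m (suc (suc k))) (σB m k) (σB m (suc k)) (σB m (suc (suc k)))
         (+ m + 1ℤ) 1ℤ
         (σP-quadratic m k) (σB-quadratic m k) (σPB-quadratic m k)
         (σP-discriminant-nonNeg m k k+1≤m) (σB-discriminant-nonNeg m k) (σP*σB-nonNeg m k k+1≤m)
         (σprev-σ-logConcave m k) (σ-logConcave m k) (σprev-σ-ratio m k))

ρ-weighted-ratio : ∀ m {p q} → p ≤ q → + (m ∸ p) * ρ m p * ρ m (suc q) ≤ℤ + (m ∸ q) * ρ m (suc p) * ρ m q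
ρ-weighted-ratio m {p} {q} p≤q with suc q ≤? m
... | no q+1≰m = x≡0⇒x≤y _ (0≤i*j (0≤i*j (0≤+n (m ∸ q)) (ρ-nonNeg m (suc p))) (ρ-nonNeg m q))
      (trans (cong (_*_ (+ (m ∸ p) * ρ m p)) (ρ-vanish m (suc q) (ℕ.≰⇒> q+1≰m))) (ℤ.*-zeroʳ (+ (m ∸ p) * ρ m p)))
... | yes q<m = *-cancelˡ-≤-0< 0<F
      (subst₂ _≤ℤ_ σ-lhs σ-rhs (logConcave-ratio (σ m) m (σ-nonNeg m) (σ-pos m) (σ-vanish m) (σ-logConcave m) p≤q))
  where
  F = factℤ (m ∸ suc p) * factℤ (m ∸ suc q)
  0<F : 0ℤ <ℤ F
  0<F = 0<i*j (factℤ-pos (m ∸ suc p)) (factℤ-pos (m ∸ suc q))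
  regroupˡ : ∀ a b c d e → ((a * b) * c) * (d * e) ≡ (b * d) * ((a * c) * e)
  regroupˡ = solve-∀
  regroupʳ : ∀ a b c d e → (b * c) * ((a * d) * e) ≡ (b * d) * ((a * c) * e)
  regroupʳ = solve-∀
  σ-lhs : σ m p * σ m (suc q) ≡ F * (+ (m ∸ p) * ρ m p * ρ m (suc q))
  σ-lhs = trans (cong (λ f → (f * ρ m p) * σ m (suc q)) (factℤ-∸ (ℕ.≤-<-trans p≤q q<m)))
                (regroupˡ (+ (m ∸ p)) (factℤ (m ∸ suc p)) (ρ m p) (factℤ (m ∸ suc q)) (ρ m (suc q)))
  σ-rhs : σ m (suc p) * σ m q ≡ F * (+ (m ∸ q) * ρ m (suc p) * ρ m q)
  σ-rhs = trans (cong (λ f → σ m (suc p) * (f * ρ m q)) (factℤ-∸ q<m))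
                (regroupʳ (+ (m ∸ q)) (factℤ (m ∸ suc p)) (ρ m (suc p)) (factℤ (m ∸ suc q)) (ρ m q))

ρ-ratio : ∀ m {p q} → p ≤ q → ρ m p * ρ m (suc q) ≤ℤ ρ m (suc p) * ρ m q
ρ-ratio m {p} {q} p≤q with p <? m
... | no p≮m = x≡0⇒x≤y _ (0≤i*j (ρ-nonNeg m (suc p)) (ρ-nonNeg m q))
      (trans (cong (_*_ (ρ m p)) (ρ-vanish m (suc q) (s≤s (ℕ.≤-trans (ℕ.≮⇒≥ p≮m) p≤q)))) (ℤ.*-zeroʳ (ρ m p)))
... | yes p<m = *-cancelˡ-≤-0< 0<m-p
      (subst₂ _≤ℤ_ (ℤ.*-assoc c (ρ m p) (ρ m (suc q))) (ℤ.*-assoc c (ρ m (suc p)) (ρ m q))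
        (ℤ.≤-trans (ρ-weighted-ratio m p≤q)
          (*-mono-≤-0≤ (0≤i*j (0≤+n (m ∸ q)) (ρ-nonNeg m (suc p)))
                       (*-mono-≤-0≤ (0≤+n (m ∸ q)) (+≤+ (ℕ.∸-monoʳ-≤ m p≤q)) (ρ-nonNeg m (suc p)) ℤ.≤-refl)
                       (ρ-nonNeg m q) ℤ.≤-refl)))
  where
  c = + (m ∸ p)
  0<m-p : 0ℤ <ℤ c
  0<m-p = +<+ (ℕ.m<n⇒0<n∸m p<m)

ρ-TP₂-step : ∀ a {l i} → l < i → ρ (suc a) l * ρ a i ≤ℤ ρ (suc a) i * ρ a l
ρ-TP₂-step a {zero} {suc i} _ = ℤ.0≤i-j⇒j≤i
  (subst (0ℤ ≤ℤ_) (sym (expand (+ a + 1ℤ) (+ a + + i + 1ℤ) (ρ a 0) (ρ a (suc i)) (ρ a i)))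
         (0≤i*j (0≤i*j (0≤a+k+1 a i) (ρ-nonNeg a i)) (ρ-nonNeg a 0)))
  where expand : ∀ A B R₀ Rᵢ Rᵢ₋₁ → (A * Rᵢ + B * Rᵢ₋₁) * R₀ - (A * R₀) * Rᵢ ≡ B * Rᵢ₋₁ * R₀
        expand = solve-∀
ρ-TP₂-step a {suc l} {suc i} (s≤s l<i) = ℤ.0≤i-j⇒j≤i
  (subst (0ℤ ≤ℤ_) (sym (expand (+ a + 1ℤ) Bₗ Bᵢ (ρ a (suc l)) (ρ a l) (ρ a (suc i)) (ρ a i)))
         (ℤ.i≤j⇒0≤j-i (subst₂ _≤ℤ_ (sym (ℤ.*-assoc Bₗ (ρ a l) (ρ a (suc i))))
                                  (trans (cong (_*_ Bᵢ) (ℤ.*-comm (ρ a (suc l)) (ρ a i)))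
                                         (sym (ℤ.*-assoc Bᵢ (ρ a i) (ρ a (suc l)))))
                                  weighted)))
  where
  Bₗ = + a + + l + 1ℤ
  Bᵢ = + a + + i + 1ℤ
  expand : ∀ A Bₗ Bᵢ Rₗ Rₗ₋₁ Rᵢ Rᵢ₋₁ →
    (A * Rᵢ + Bᵢ * Rᵢ₋₁) * Rₗ - (A * Rₗ + Bₗ * Rₗ₋₁) * Rᵢ ≡ Bᵢ * Rᵢ₋₁ * Rₗ - Bₗ * Rₗ₋₁ * Rᵢ
  expand = solve-∀
  weighted : Bₗ * (ρ a l * ρ a (suc i)) ≤ℤ Bᵢ * (ρ a (suc l) * ρ a i)
  weighted = *-mono-≤-0≤ (0≤a+k+1 a l) (ℤ.+-monoˡ-≤ 1ℤ (ℤ.+-monoʳ-≤ (+ a) (+≤+ (ℕ.<⇒≤ l<i))))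
                         (0≤i*j (ρ-nonNeg a l) (ρ-nonNeg a (suc i))) (ρ-ratio a (ℕ.<⇒≤ l<i))

ρ-TP₂ : ∀ {b a} → b < a → ∀ {l i} → l < i → ρ a l * ρ b i ≤ℤ ρ a i * ρ b l
ρ-TP₂ {b} {suc a} (s≤s b≤a) {l} {i} l<i =
  subst (λ t → ρ (suc t) l * ρ b i ≤ℤ ρ (suc t) i * ρ b l) (ℕ.m∸n+n≡m b≤a) (from-gap (a ∸ b))
  where
  from-gap : ∀ d → ρ (suc (d +ℕ b)) l * ρ b i ≤ℤ ρ (suc (d +ℕ b)) i * ρ b l
  from-gap zero = ρ-TP₂-step b l<i
  from-gap (suc d) with i ≤? b
  ... | no i≰b = x≡0⇒x≤y _ (0≤i*j (ρ-nonNeg (suc c) i) (ρ-nonNeg b l))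
        (trans (cong (_*_ (ρ (suc c) l)) (ρ-vanish b i (ℕ.≰⇒> i≰b))) (ℤ.*-zeroʳ (ρ (suc c) l)))
    where c = suc (d +ℕ b)
  ... | yes i≤b = *-cancelˡ-≤-0< 0<ρcᵢρcₗ
        (subst₂ _≤ℤ_ (regroupˡ (ρ (suc c) l) (ρ c i) (ρ c l) (ρ b i))
                     (regroupʳ (ρ (suc c) i) (ρ c l) (ρ c i) (ρ b l))
          (*-mono-≤-0≤ (0≤i*j (ρ-nonNeg (suc c) l) (ρ-nonNeg c i)) (ρ-TP₂-step c l<i)
                       (0≤i*j (ρ-nonNeg c l) (ρ-nonNeg b i)) (from-gap d)))
    where
    c = suc (d +ℕ b)
    i≤c : i ≤ c
    i≤c = ℕ.≤-trans i≤b (ℕ.≤-trans (ℕ.m≤n+m b d) (ℕ.n≤1+n _))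
    0<ρcᵢρcₗ : 0ℤ <ℤ ρ c i * ρ c l
    0<ρcᵢρcₗ = 0<i*j (ρ-pos c i i≤c) (ρ-pos c l (ℕ.≤-trans (ℕ.<⇒≤ l<i) i≤c))
    regroupˡ : ∀ x y z w → (x * y) * (z * w) ≡ (y * z) * (x * w)
    regroupˡ = solve-∀
    regroupʳ : ∀ x y z w → (x * y) * (z * w) ≡ (z * y) * (x * w)
    regroupʳ = solve-∀

-- β as a binomial transform of ρ

-- The coefficients of Σ_{i ≤ A} x i (1+q)^(A-i).
binomialTransform : ℕ → (ℕ → ℤ) → Poly
binomialTransform A x J = sumTo A (λ i → x i * Cℤ (A ∸ i) J)

-- The β-recurrence applied to the single term ρ m i (1+q)^(m-i) yields exactly the two
-- contributions of ρ m i to the terms of index i and i+1 of the next row.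
β-termwise : ∀ m k i → i ≤ m →
  (+ m + 1ℤ) * ρ m i * Cℤ (suc m ∸ i) k + (+ m + + i + 1ℤ) * ρ m i * Cℤ (m ∸ i) k
  ≡ ((+ 3) * (+ m + 1ℤ) - + k - 1ℤ) * (ρ m i * Cℤ (m ∸ i) k) + (1ℤ + + m) * (ρ m i * Cprevℤ (m ∸ i) k)
    - (1ℤ + + k) * (ρ m i * Cℤ (m ∸ i) (suc k))
β-termwise m k i i≤m =
  trans (cong (λ c → (+ m + 1ℤ) * ρ m i * c + (+ m + + i + 1ℤ) * ρ m i * Cℤ (m ∸ i) k)
              (trans (cong (λ t → Cℤ t k) (1+n∸m≡1+[n∸m] i≤m)) (Cℤ-pascal (m ∸ i) k))) (
  ℤ.i-j≡0⇒i≡j _ _ (trans (expand (ρ m i) (Cprevℤ (m ∸ i) k) (Cℤ (m ∸ i) k) (Cℤ (m ∸ i) (suc k)) (+ m) (+ i) (+ k))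
                   (trans (cong (λ z → ρ m i * (z - (+ m - + i) * Cℤ (m ∸ i) k)) (Cℤ-absorption-∸ k i≤m))
                          (trans (cong (ρ m i *_) (ℤ.+-inverseʳ ((+ m - + i) * Cℤ (m ∸ i) k))) (ℤ.*-zeroʳ (ρ m i))))))
  where
  expand : ∀ R P C₀ C₁ M I K →
    ((M + 1ℤ) * R * (P + C₀) + (M + I + 1ℤ) * R * C₀)
      - (((+ 3) * (M + 1ℤ) - K - 1ℤ) * (R * C₀) + (1ℤ + M) * (R * P) - (1ℤ + K) * (R * C₁))
    ≡ R * (((1ℤ + K) * C₁ + K * C₀) - (M - I) * C₀)
  expand = solve-∀

binomialTransform-ρ-suc : ∀ m k → binomialTransform (suc m) (ρ (suc m)) k
  ≡ sumTo m (λ i → (+ m + 1ℤ) * ρ m i * Cℤ (suc m ∸ i) k + (+ m + + i + 1ℤ) * ρ m i * Cℤ (m ∸ i) k)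
binomialTransform-ρ-suc m k = begin
    binomialTransform (suc m) (ρ (suc m)) k
  ≡⟨ sumTo-head m _ ⟩
    ρ (suc m) 0 * Cℤ (suc m) k + sumTo m (λ i → ρ (suc m) (suc i) * Cℤ (m ∸ i) k)
  ≡⟨ cong (_+_ (g 0)) (sumTo-cong m (λ i _ →
       distrib (+ m + 1ℤ) (ρ m (suc i)) (+ m + + i + 1ℤ) (ρ m i) (Cℤ (m ∸ i) k))) ⟩
    g 0 + sumTo m (λ i → g (suc i) + h i)
  ≡⟨ cong (_+_ (g 0)) (sumTo-+ m (λ i → g (suc i)) h) ⟩
    g 0 + (sumTo m (λ i → g (suc i)) + sumTo m h)
  ≡⟨ sym (ℤ.+-assoc (g 0) (sumTo m (λ i → g (suc i))) (sumTo m h)) ⟩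
    (g 0 + sumTo m (λ i → g (suc i))) + sumTo m h
  ≡⟨ cong (_+ sumTo m h) (sym (sumTo-head m g)) ⟩
    sumTo (suc m) g + sumTo m h
  ≡⟨ cong (_+ sumTo m h) (sumTo-extend g (ℕ.n≤1+n m) g-vanish) ⟩
    sumTo m g + sumTo m h
  ≡⟨ sym (sumTo-+ m g h) ⟩
    sumTo m (λ i → g i + h i)
  ∎
  where
  open ≡-Reasoning
  g h : ℕ → ℤ
  g i = (+ m + 1ℤ) * ρ m i * Cℤ (suc m ∸ i) k
  h i = (+ m + + i + 1ℤ) * ρ m i * Cℤ (m ∸ i) k
  g-vanish : ∀ i → m < i → g i ≡ 0ℤ
  g-vanish i m<i rewrite ρ-vanish m i m<i | ℤ.*-zeroʳ (+ m + 1ℤ) = ℤ.*-zeroˡ (Cℤ (suc m ∸ i) k)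
  distrib : ∀ A r₁ B r₀ c → (A * r₁ + B * r₀) * c ≡ A * r₁ * c + B * r₀ * c
  distrib = solve-∀

β≡binomialTransform : ∀ m k → β (suc m) k ≡ binomialTransform m (ρ m) k
βprev≡sumTo : ∀ m k → βprev (suc m) k ≡ sumTo m (λ i → ρ m i * Cprevℤ (m ∸ i) k)

βprev≡sumTo m zero = sym (sumTo-0 m _ (λ i _ → ℤ.*-zeroʳ (ρ m i)))
βprev≡sumTo m (suc k) = β≡binomialTransform m k

β≡binomialTransform zero zero = refl
β≡binomialTransform zero (suc k) = sym (cong (λ c → 1ℤ * + c) (k>n⇒nCk≡0 {0} {suc k} (s≤s z≤n)))
β≡binomialTransform (suc m) k = begin
    β (suc (suc m)) k
  ≡⟨ cong₂ _-_ (cong₂ _+_ (cong₂ _*_ (cong (λ z → z - K - 1ℤ) 3[m+1]) (β≡binomialTransform m k))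
                          (cong₂ _*_ (+[1+n]≡1+n m) (βprev≡sumTo m k)))
               (cong₂ _*_ (+[1+n]≡1+n k) (β≡binomialTransform m (suc k))) ⟩
    c₁ * sumTo m u + (1ℤ + M) * sumTo m v - (1ℤ + K) * sumTo m w
  ≡⟨ sym (sumTo-lincomb (1ℤ + M) (1ℤ + K)) ⟩
    sumTo m (λ i → c₁ * u i + (1ℤ + M) * v i - (1ℤ + K) * w i)
  ≡⟨ sym (sumTo-cong m (β-termwise m k)) ⟩
    sumTo m (λ i → (M + 1ℤ) * ρ m i * Cℤ (suc m ∸ i) k + (M + + i + 1ℤ) * ρ m i * Cℤ (m ∸ i) k)
  ≡⟨ sym (binomialTransform-ρ-suc m k) ⟩
    binomialTransform (suc m) (ρ (suc m)) k
  ∎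
  where
  open ≡-Reasoning
  M = + m
  K = + k
  c₁ = (+ 3) * (M + 1ℤ) - K - 1ℤ
  u v w : ℕ → ℤ
  u i = ρ m i * Cℤ (m ∸ i) k
  v i = ρ m i * Cprevℤ (m ∸ i) k
  w i = ρ m i * Cℤ (m ∸ i) (suc k)
  3[m+1] : + (3 *ℕ suc m) ≡ (+ 3) * (M + 1ℤ)
  3[m+1] = trans (ℤ.pos-* 3 (suc m)) (cong (_*_ (+ 3)) (trans (+[1+n]≡1+n m) (ℤ.+-comm 1ℤ M)))
  sumTo-lincomb : ∀ a b → sumTo m (λ i → c₁ * u i + a * v i - b * w i) ≡ c₁ * sumTo m u + a * sumTo m v - b * sumTo m w
  sumTo-lincomb a b = trans (sumTo-- m (λ i → c₁ * u i + a * v i) (λ i → b * w i))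
    (cong₂ _-_ (trans (sumTo-+ m (λ i → c₁ * u i) (λ i → a * v i)) (cong₂ _+_ (sumTo-*ˡ m c₁ u) (sumTo-*ˡ m a v)))
               (sumTo-*ˡ m b w))

β-pos : ∀ n k → 1 ≤ n → k < n → + 0 <ℤ β n k
β-pos (suc m) k _ (s≤s k≤m) = subst (0ℤ <ℤ_) (sym (β≡binomialTransform m k))
  (ℤ.<-≤-trans (0<i*j (ρ-pos m 0 z≤n) (+<+ (nCk>0 k≤m)))
               (f0≤sumTo m _ (λ i → 0≤i*j (ρ-nonNeg m i) (0≤+n ((m ∸ i) C k)))))

-- Log-concavity of the rows of β

sumTo-binetCauchy : ∀ M (a b u v : ℕ → ℤ) →
  + 2 * (sumTo M (λ p → u p * a p) * sumTo M (λ q → v q * b q) - sumTo M (λ p → v p * a p) * sumTo M (λ q → u q * b q))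
  ≡ sumTo M (λ p → sumTo M (λ q → (a p * b q - a q * b p) * (u p * v q - u q * v p)))
sumTo-binetCauchy M a b u v = sym (begin
    sumTo M (λ p → sumTo M (λ q → (a p * b q - a q * b p) * (u p * v q - u q * v p)))
  ≡⟨ sumTo-cong M (λ p _ → trans (sumTo-cong M (λ q _ → expand (a p) (b p) (u p) (v p) (a q) (b q) (u q) (v q)))
                                 (sumTo-±± M _ _ _ _)) ⟩
    sumTo M (λ p → S (λ q → ua p * vb q) - S (λ q → va p * ub q) - S (λ q → ub p * va q) + S (λ q → vb p * ua q))
  ≡⟨ sumTo-±± M _ _ _ _ ⟩
    S (λ p → S (λ q → ua p * vb q)) - S (λ p → S (λ q → va p * ub q))
      - S (λ p → S (λ q → ub p * va q)) + S (λ p → S (λ q → vb p * ua q))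
  ≡⟨ sym (cong₂ _+_ (cong₂ _-_ (cong₂ _-_ (sumTo-*-sumTo M M ua vb) (sumTo-*-sumTo M M va ub))
                                (sumTo-*-sumTo M M ub va))
                    (sumTo-*-sumTo M M vb ua)) ⟩
    S ua * S vb - S va * S ub - S ub * S va + S vb * S ua
  ≡⟨ double (S ua) (S vb) (S va) (S ub) ⟩
    + 2 * (S ua * S vb - S va * S ub)
  ∎)
  where
  open ≡-Reasoning
  S : (ℕ → ℤ) → ℤ
  S = sumTo M
  ua va ub vb : ℕ → ℤ
  ua p = u p * a p
  va p = v p * a p
  ub p = u p * b p
  vb p = v p * b p
  sumTo-±± : ∀ N (f g h k : ℕ → ℤ) → sumTo N (λ i → f i - g i - h i + k i) ≡ sumTo N f - sumTo N g - sumTo N h + sumTo N k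
  sumTo-±± N f g h k = trans (sumTo-+ N (λ i → f i - g i - h i) k)
    (cong (_+ sumTo N k) (trans (sumTo-- N (λ i → f i - g i) h) (cong (_- sumTo N h) (sumTo-- N f g))))
  expand : ∀ aₚ bₚ uₚ vₚ a_q b_q u_q v_q → (aₚ * b_q - a_q * bₚ) * (uₚ * v_q - u_q * vₚ)
       ≡ (uₚ * aₚ) * (v_q * b_q) - (vₚ * aₚ) * (u_q * b_q) - (uₚ * bₚ) * (v_q * a_q) + (vₚ * bₚ) * (u_q * a_q)
  expand = solve-∀
  double : ∀ x y z w → x * y - z * w - w * z + y * x ≡ + 2 * (x * y - z * w)
  double = solve-∀

-- The coefficients of d/dq Σ_{i ≤ A} x i (1+q)^(A-i), again expanded in powers of (1+q).
derivCoeff : ℕ → (ℕ → ℤ) → ℕ → ℤ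
derivCoeff A x zero = 0ℤ
derivCoeff A x (suc i) = + (A ∸ i) * x i

binomialTransform-derivCoeff : ∀ A x t →
  binomialTransform A (derivCoeff A x) t ≡ + suc t * binomialTransform A x (suc t)
binomialTransform-derivCoeff zero x t = trans (ℤ.*-zeroˡ (Cℤ 0 t))
  (sym (trans (cong (λ c → + suc t * (x 0 * + c)) (k>n⇒nCk≡0 {0} {suc t} (s≤s z≤n)))
              (trans (cong (_*_ (+ suc t)) (ℤ.*-zeroʳ (x 0))) (ℤ.*-zeroʳ (+ suc t)))))
binomialTransform-derivCoeff (suc m) x t = begin
    sumTo (suc m) (λ i → derivCoeff (suc m) x i * Cℤ (suc m ∸ i) t)
  ≡⟨ sumTo-head m _ ⟩
    0ℤ * Cℤ (suc m) t + sumTo m (λ i → (+ (suc m ∸ i) * x i) * Cℤ (m ∸ i) t)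
  ≡⟨ cong₂ _+_ (ℤ.*-zeroˡ (Cℤ (suc m) t)) (trans (sumTo-cong m absorb) (sumTo-*ˡ m (+ suc t) _)) ⟩
    0ℤ + + suc t * sumTo m (λ i → x i * Cℤ (suc m ∸ i) (suc t))
  ≡⟨ ℤ.+-identityˡ _ ⟩
    + suc t * sumTo m (λ i → x i * Cℤ (suc m ∸ i) (suc t))
  ≡⟨ cong (_*_ (+ suc t)) (sym (trans (cong (_+_ (sumTo m (λ i → x i * Cℤ (suc m ∸ i) (suc t)))) last-term≡0)
                                      (ℤ.+-identityʳ _))) ⟩
    + suc t * binomialTransform (suc m) x (suc t)
  ∎
  where
  open ≡-Reasoning
  last-term≡0 : x (suc m) * Cℤ (suc m ∸ suc m) (suc t) ≡ 0ℤ
  last-term≡0 = trans (cong (λ j → x (suc m) * + (j C suc t)) (ℕ.n∸n≡0 m))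
    (trans (cong (λ c → x (suc m) * + c) (k>n⇒nCk≡0 {0} {suc t} (s≤s z≤n))) (ℤ.*-zeroʳ (x (suc m))))
  regroupˡ : ∀ s r b → (s * r) * b ≡ r * (s * b)
  regroupˡ = solve-∀
  regroupʳ : ∀ c r b → r * (c * b) ≡ c * (r * b)
  regroupʳ = solve-∀
  absorb : ∀ i → i ≤ m → (+ (suc m ∸ i) * x i) * Cℤ (m ∸ i) t ≡ + suc t * (x i * Cℤ (suc m ∸ i) (suc t))
  absorb i i≤m rewrite 1+n∸m≡1+[n∸m] i≤m = trans (regroupˡ (+ suc (m ∸ i)) (x i) (Cℤ (m ∸ i) t))
    (trans (cong (_*_ (x i)) (Cℤ-absorption (m ∸ i) t)) (regroupʳ (+ suc t) (x i) (Cℤ (suc (m ∸ i)) (suc t))))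

ρ-derivCoeff-ratio : ∀ m {p q} → p < q → 0ℤ ≤ℤ ρ m p * derivCoeff m (ρ m) q - ρ m q * derivCoeff m (ρ m) p
ρ-derivCoeff-ratio m {zero} {suc q} _ =
  subst (0ℤ ≤ℤ_) (sym (drop (ρ m 0) (+ (m ∸ q) * ρ m q) (ρ m (suc q))))
        (0≤i*j (ρ-nonNeg m 0) (0≤i*j (0≤+n (m ∸ q)) (ρ-nonNeg m q)))
  where drop : ∀ a b c → a * b - c * 0ℤ ≡ a * b
        drop = solve-∀
ρ-derivCoeff-ratio m {suc p} {suc q} (s≤s p<q) =
  subst (0ℤ ≤ℤ_) (regroup (+ (m ∸ p)) (+ (m ∸ q)) (ρ m p) (ρ m (suc p)) (ρ m q) (ρ m (suc q)))
        (ℤ.i≤j⇒0≤j-i (ρ-weighted-ratio m (ℕ.<⇒≤ p<q)))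
  where regroup : ∀ mp mq rp rsp rq rsq → mq * rsp * rq - mp * rp * rsq ≡ rsp * (mq * rq) - rsq * (mp * rp)
        regroup = solve-∀

minor-sign : ∀ (x y : ℕ → ℤ) → (∀ {p q} → p < q → 0ℤ ≤ℤ x p * y q - x q * y p) →
  ∀ p q → 0ℤ ≤ℤ (+ q - + p) * (x p * y q - x q * y p)
minor-sign x y h p q with ℕ.<-cmp p q
... | tri< p<q _ _ = 0≤i*j (ℤ.i≤j⇒0≤j-i (+≤+ (ℕ.<⇒≤ p<q))) (h p<q)
... | tri≈ _ refl _ = subst (0ℤ ≤ℤ_) (sym (vanish (+ p) (x p * y p))) (+≤+ z≤n)
  where vanish : ∀ P a → (P - P) * (a - a) ≡ 0ℤ
        vanish = solve-∀
... | tri> _ _ q<p = subst (0ℤ ≤ℤ_) (flip (+ p) (+ q) (x p) (x q) (y p) (y q))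
                          (0≤i*j (ℤ.i≤j⇒0≤j-i (+≤+ (ℕ.<⇒≤ q<p))) (h q<p))
  where flip : ∀ P Q xp xq yp yq → (P - Q) * (xq * yp - xp * yq) ≡ (Q - P) * (xp * yq - xq * yp)
        flip = solve-∀

Cℤ-minor : ∀ m k {p q} → p ≤ m → q ≤ m →
  (1ℤ + + k) * (Cℤ (m ∸ p) (suc k) * Cℤ (m ∸ q) k - Cℤ (m ∸ q) (suc k) * Cℤ (m ∸ p) k)
  ≡ (+ q - + p) * (Cℤ (m ∸ p) k * Cℤ (m ∸ q) k)
Cℤ-minor m k {p} {q} p≤m q≤m = ℤ.i-j≡0⇒i≡j _ _ (trans
    (expand (Cℤ (m ∸ p) (suc k)) (Cℤ (m ∸ p) k) (Cℤ (m ∸ q) (suc k)) (Cℤ (m ∸ q) k) (+ m) (+ p) (+ q) (+ k))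
    (trans (cong₂ (λ x y → (x - (+ m - + p) * Cℤ (m ∸ p) k) * Cℤ (m ∸ q) k
                         - (y - (+ m - + q) * Cℤ (m ∸ q) k) * Cℤ (m ∸ p) k)
                  (Cℤ-absorption-∸ k p≤m) (Cℤ-absorption-∸ k q≤m))
           (vanish ((+ m - + p) * Cℤ (m ∸ p) k) ((+ m - + q) * Cℤ (m ∸ q) k) (Cℤ (m ∸ p) k) (Cℤ (m ∸ q) k))))
  where
  expand : ∀ Aₚ Bₚ A_q B_q M P Q K → (1ℤ + K) * (Aₚ * B_q - A_q * Bₚ) - (Q - P) * (Bₚ * B_q)
        ≡ (((1ℤ + K) * Aₚ + K * Bₚ) - (M - P) * Bₚ) * B_q - (((1ℤ + K) * A_q + K * B_q) - (M - Q) * B_q) * Bₚ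
  expand = solve-∀
  vanish : ∀ x y Bₚ B_q → (x - x) * B_q - (y - y) * Bₚ ≡ 0ℤ
  vanish = solve-∀

β-logConcave-term : ∀ m k {p q} → p ≤ m → q ≤ m →
  0ℤ ≤ℤ (Cℤ (m ∸ p) (suc k) * Cℤ (m ∸ q) k - Cℤ (m ∸ q) (suc k) * Cℤ (m ∸ p) k)
        * (ρ m p * derivCoeff m (ρ m) q - ρ m q * derivCoeff m (ρ m) p)
β-logConcave-term m k {p} {q} p≤m q≤m = *-cancelˡ-≤-0< (0<1+n k)
  (subst (_≤ℤ + suc k * (Δ * W)) (sym (ℤ.*-zeroʳ (+ suc k)))
    (subst (0ℤ ≤ℤ_) (sym k+1*ΔW)
      (0≤i*j (minor-sign (ρ m) (derivCoeff m (ρ m)) (ρ-derivCoeff-ratio m) p q)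
             (0≤i*j (0≤+n ((m ∸ p) C k)) (0≤+n ((m ∸ q) C k))))))
  where
  Δ = Cℤ (m ∸ p) (suc k) * Cℤ (m ∸ q) k - Cℤ (m ∸ q) (suc k) * Cℤ (m ∸ p) k
  W = ρ m p * derivCoeff m (ρ m) q - ρ m q * derivCoeff m (ρ m) p
  regroup : ∀ c Δ W d B → c * Δ ≡ d * B → c * (Δ * W) ≡ (d * W) * B
  regroup c Δ W d B h = trans (sym (ℤ.*-assoc c Δ W)) (trans (cong (_* W) h) (swap d B W))
    where swap : ∀ d B W → (d * B) * W ≡ (d * W) * B
          swap = solve-∀
  k+1*ΔW : + suc k * (Δ * W) ≡ ((+ q - + p) * W) * (Cℤ (m ∸ p) k * Cℤ (m ∸ q) k)
  k+1*ΔW = regroup (+ suc k) Δ W (+ q - + p) _ (trans (cong (_* Δ) (+[1+n]≡1+n k)) (Cℤ-minor m k p≤m q≤m))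

β-logConcave : ∀ m → LogConcave (β (suc m))
β-logConcave m k
  rewrite β≡binomialTransform m k | β≡binomialTransform m (suc k) | β≡binomialTransform m (suc (suc k)) =
  ℤ.0≤i-j⇒j≤i (*-cancelˡ-≤-0< (0<1+n (suc k))
    (subst (_≤ℤ + suc (suc k) * (Y₁ * Y₁ - Y₀ * Y₂)) (sym (ℤ.*-zeroʳ (+ suc (suc k))))
      (subst (0ℤ ≤ℤ_) (sym k+2*defect) (0≤i+j (0≤2*i⇒0≤i 0≤2D) (0≤i*i Y₁)))))
  where
  Y = binomialTransform m (ρ m)
  Y₀ = Y k
  Y₁ = Y (suc k)
  Y₂ = Y (suc (suc k))
  D = Y₁ * (+ suc k * Y₁) - (+ suc (suc k) * Y₂) * Y₀
  2D≡ : + 2 * D ≡ sumTo m (λ p → sumTo m (λ q →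
          (Cℤ (m ∸ p) (suc k) * Cℤ (m ∸ q) k - Cℤ (m ∸ q) (suc k) * Cℤ (m ∸ p) k)
          * (ρ m p * derivCoeff m (ρ m) q - ρ m q * derivCoeff m (ρ m) p)))
  2D≡ = trans (cong (λ z → + 2 * z) (cong₂ (λ x y → Y₁ * x - y * Y₀)
                                       (sym (binomialTransform-derivCoeff m (ρ m) k))
                                       (sym (binomialTransform-derivCoeff m (ρ m) (suc k)))))
              (sumTo-binetCauchy m (λ i → Cℤ (m ∸ i) (suc k)) (λ i → Cℤ (m ∸ i) k) (ρ m) (derivCoeff m (ρ m)))
  0≤2D : 0ℤ ≤ℤ + 2 * D
  0≤2D = subst (0ℤ ≤ℤ_) (sym 2D≡)
    (sumTo-nonNeg m _ (λ p p≤m → sumTo-nonNeg m _ (λ q q≤m → β-logConcave-term m k p≤m q≤m)))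
  k+2*defect : + suc (suc k) * (Y₁ * Y₁ - Y₀ * Y₂) ≡ D + Y₁ * Y₁
  k+2*defect = trans (cong (λ z → z * (Y₁ * Y₁ - Y₀ * Y₂)) (+[1+n]≡1+n (suc k)))
    (trans (expand (+ suc k) Y₀ Y₁ Y₂)
           (cong (λ z → Y₁ * (+ suc k * Y₁) - (z * Y₂) * Y₀ + Y₁ * Y₁) (sym (+[1+n]≡1+n (suc k)))))
    where expand : ∀ K₁ Y₀ Y₁ Y₂ → (1ℤ + K₁) * (Y₁ * Y₁ - Y₀ * Y₂) ≡ Y₁ * (K₁ * Y₁) - ((1ℤ + K₁) * Y₂) * Y₀ + Y₁ * Y₁
          expand = solve-∀

-- Strong q-log-convexity

·-cong : ∀ {p p′ r r′ : Poly} → (∀ i → p i ≡ p′ i) → (∀ i → r i ≡ r′ i) → ∀ J → (p · r) J ≡ (p′ · r′) J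
·-cong hp hr J = sumTo-cong J (λ i _ → cong₂ _*_ (hp i) (hr (J ∸ i)))

·-nonNeg : ∀ (x y : Poly) → (∀ i → 0ℤ ≤ℤ x i) → (∀ i → 0ℤ ≤ℤ y i) → NonnegCoeffs (x · y)
·-nonNeg x y 0≤x 0≤y J = sumTo-nonNeg J _ (λ i _ → 0≤i*j (0≤x i) (0≤y (J ∸ i)))

[a+b]∸[i+l]≡[a∸i]+[b∸l] : ∀ {a b i l} → i ≤ a → l ≤ b → (a +ℕ b) ∸ (i +ℕ l) ≡ (a ∸ i) +ℕ (b ∸ l)
[a+b]∸[i+l]≡[a∸i]+[b∸l] {a} {b} {i} {l} i≤a l≤b = begin
    (a +ℕ b) ∸ (i +ℕ l)  ≡⟨ sym (ℕ.∸-+-assoc (a +ℕ b) i l) ⟩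
    ((a +ℕ b) ∸ i) ∸ l   ≡⟨ cong (_∸ l) (ℕ.+-∸-comm b i≤a) ⟩
    ((a ∸ i) +ℕ b) ∸ l   ≡⟨ ℕ.+-∸-assoc (a ∸ i) l≤b ⟩
    (a ∸ i) +ℕ (b ∸ l)   ∎
  where open ≡-Reasoning

binomialTransform-·-doubleSum : ∀ A B (x z : ℕ → ℤ) J → (binomialTransform A x · binomialTransform B z) J
  ≡ sumTo A (λ i → sumTo B (λ l → (x i * z l) * Cℤ ((A +ℕ B) ∸ (i +ℕ l)) J))
binomialTransform-·-doubleSum A B x z J = begin
    sumTo J (λ j → binomialTransform A x j * binomialTransform B z (J ∸ j))
  ≡⟨ sumTo-cong J (λ j _ → trans (sumTo-*-sumTo A B _ _)
       (sumTo-cong A (λ i _ → sumTo-cong B (λ l _ → regroup (x i) (Cℤ (A ∸ i) j) (z l) (Cℤ (B ∸ l) (J ∸ j)))))) ⟩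
    sumTo J (λ j → sumTo A (λ i → sumTo B (λ l → (x i * z l) * (Cℤ (A ∸ i) j * Cℤ (B ∸ l) (J ∸ j)))))
  ≡⟨ sumTo-comm J A _ ⟩
    sumTo A (λ i → sumTo J (λ j → sumTo B (λ l → (x i * z l) * (Cℤ (A ∸ i) j * Cℤ (B ∸ l) (J ∸ j)))))
  ≡⟨ sumTo-cong A (λ i i≤A → trans (sumTo-comm J B _) (sumTo-cong B (λ l l≤B →
       trans (sumTo-*ˡ J (x i * z l) _)
             (cong (_*_ (x i * z l)) (trans (vandermonde (A ∸ i) (B ∸ l) J)
                                            (cong (λ t → Cℤ t J) (sym ([a+b]∸[i+l]≡[a∸i]+[b∸l] i≤A l≤B)))))))) ⟩
    sumTo A (λ i → sumTo B (λ l → (x i * z l) * Cℤ ((A +ℕ B) ∸ (i +ℕ l)) J))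
  ∎
  where
  open ≡-Reasoning
  regroup : ∀ xᵢ a z_l b → (xᵢ * a) * (z_l * b) ≡ (xᵢ * z_l) * (a * b)
  regroup = solve-∀

binomialTransform-convolution-doubleSum : ∀ A B (x z : ℕ → ℤ) →
  (∀ i → A < i → x i ≡ 0ℤ) → (∀ i → B < i → z i ≡ 0ℤ) → ∀ J →
  binomialTransform (A +ℕ B) (x · z) J ≡ sumTo A (λ i → sumTo B (λ l → (x i * z l) * Cℤ ((A +ℕ B) ∸ (i +ℕ l)) J))
binomialTransform-convolution-doubleSum A B x z x-vanish z-vanish J = begin
    sumTo N (λ u → (x · z) u * Cℤ (N ∸ u) J)
  ≡⟨ sumTo-cong N (λ u _ → trans (sym (sumTo-*ʳ u (Cℤ (N ∸ u) J) _))
       (sumTo-cong u (λ i i≤u → cong (λ t → (x i * z (u ∸ i)) * Cℤ (N ∸ t) J) (sym (ℕ.m+[n∸m]≡n i≤u))))) ⟩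
    sumTo N (λ u → sumTo u (λ i → G i (u ∸ i)))
  ≡⟨ sumTo-triangle N G ⟩
    sumTo N (λ i → sumTo (N ∸ i) (G i))
  ≡⟨ sumTo-extend _ (ℕ.m≤m+n A B) (λ i A<i → sumTo-0 (N ∸ i) _ (λ l _ → G-vanishˡ i l A<i)) ⟩
    sumTo A (λ i → sumTo (N ∸ i) (G i))
  ≡⟨ sumTo-cong A (λ i i≤A → sumTo-extend (G i) (B≤N∸i i i≤A) (G-vanishʳ i)) ⟩
    sumTo A (λ i → sumTo B (G i))
  ∎
  where
  open ≡-Reasoning
  N = A +ℕ B
  G : ℕ → ℕ → ℤ
  G i l = (x i * z l) * Cℤ (N ∸ (i +ℕ l)) J
  G-vanishˡ : ∀ i l → A < i → G i l ≡ 0ℤ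
  G-vanishˡ i l A<i rewrite x-vanish i A<i =
    trans (cong (_* Cℤ (N ∸ (i +ℕ l)) J) (ℤ.*-zeroˡ (z l))) (ℤ.*-zeroˡ (Cℤ (N ∸ (i +ℕ l)) J))
  G-vanishʳ : ∀ i l → B < l → G i l ≡ 0ℤ
  G-vanishʳ i l B<l rewrite z-vanish l B<l =
    trans (cong (_* Cℤ (N ∸ (i +ℕ l)) J) (ℤ.*-zeroʳ (x i))) (ℤ.*-zeroˡ (Cℤ (N ∸ (i +ℕ l)) J))
  B≤N∸i : ∀ i → i ≤ A → B ≤ N ∸ i
  B≤N∸i i i≤A = subst (B ≤_) (sym (ℕ.+-∸-comm B i≤A)) (ℕ.m≤n+m B (A ∸ i))

binomialTransform-· : ∀ A B (x z : ℕ → ℤ) → (∀ i → A < i → x i ≡ 0ℤ) → (∀ i → B < i → z i ≡ 0ℤ) →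
  ∀ J → (binomialTransform A x · binomialTransform B z) J ≡ binomialTransform (A +ℕ B) (x · z) J
binomialTransform-· A B x z x-vanish z-vanish J =
  trans (binomialTransform-·-doubleSum A B x z J)
        (sym (binomialTransform-convolution-doubleSum A B x z x-vanish z-vanish J))

βpoly≡binomialTransform : ∀ a J → βpoly (suc a) J ≡ binomialTransform a (ρ a) J
βpoly≡binomialTransform a J with J <? suc a
... | yes _ = β≡binomialTransform a J
... | no J≮1+a = sym (sumTo-0 a _ (λ i _ →
      trans (cong (λ c → ρ a i * + c)
                  (k>n⇒nCk≡0 (ℕ.≤-<-trans (ℕ.m∸n≤m a i) (ℕ.≰⇒> (λ J≤a → J≮1+a (s≤s J≤a))))))
            (ℤ.*-zeroʳ (ρ a i))))

skewConvolution-nonNeg : ∀ (x y : ℕ → ℤ) → (∀ {p q} → p < q → 0ℤ ≤ℤ y p * x q - y q * x p) →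
  ∀ J → 0ℤ ≤ℤ sumTo J (λ i → (+ i - + (J ∸ i)) * (x i * y (J ∸ i)))
skewConvolution-nonNeg x y minor≥0 J = 0≤2*i⇒0≤i (subst (0ℤ ≤ℤ_) (sym 2S≡)
  (sumTo-nonNeg J _ (λ i _ → minor-sign y x minor≥0 (J ∸ i) i)))
  where
  G : ℕ → ℤ
  G i = (+ i - + (J ∸ i)) * (x i * y (J ∸ i))
  S = sumTo J G
  double : ∀ S → + 2 * S ≡ S + S
  double = solve-∀
  pair : ∀ a b xᵢ yⱼ xⱼ yᵢ → (a - b) * (xᵢ * yⱼ) + (b - a) * (xⱼ * yᵢ) ≡ (a - b) * (yⱼ * xᵢ - yᵢ * xⱼ)
  pair = solve-∀
  paired : ∀ i → i ≤ J → G i + G (J ∸ i) ≡ (+ i - + (J ∸ i)) * (y (J ∸ i) * x i - y i * x (J ∸ i))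
  paired i i≤J rewrite ℕ.m∸[m∸n]≡n i≤J = pair (+ i) (+ (J ∸ i)) (x i) (y (J ∸ i)) (x (J ∸ i)) (y i)
  2S≡ : + 2 * S ≡ sumTo J (λ i → (+ i - + (J ∸ i)) * (y (J ∸ i) * x i - y i * x (J ∸ i)))
  2S≡ = trans (double S) (trans (cong (_+_ S) (sumTo-reverse J G))
                               (trans (sym (sumTo-+ J G (λ i → G (J ∸ i)))) (sumTo-cong J paired)))

ρ-minor-nonNeg : ∀ {m n} → m < n → ∀ {p q} → p < q → 0ℤ ≤ℤ ρ m p * ρ n q - ρ m q * ρ n p
ρ-minor-nonNeg {m} {n} m<n {p} {q} p<q =
  subst (0ℤ ≤ℤ_) (cong₂ _-_ (ℤ.*-comm (ρ n q) (ρ m p)) (ℤ.*-comm (ρ n p) (ρ m q))) (ℤ.i≤j⇒0≤j-i (ρ-TP₂ m<n p<q))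

ρshift-·-difference : ∀ {m n} → m < n → NonnegCoeffs ((ρshift n · ρ m) − (ρ n · ρshift m))
ρshift-·-difference {m} {n} m<n zero = subst (0ℤ ≤ℤ_) (sym (vanish (ρ m 0) (ρ n 0))) (+≤+ z≤n)
  where vanish : ∀ a b → 0ℤ * a - b * 0ℤ ≡ 0ℤ
        vanish = solve-∀
ρshift-·-difference {m} {n} m<n (suc J) = subst (0ℤ ≤ℤ_) (sym difference≡)
  (0≤i+j (0≤i*j 0≤n-m (·-nonNeg x y (ρ-nonNeg n) (ρ-nonNeg m) J))
         (skewConvolution-nonNeg x y (ρ-minor-nonNeg m<n) J))
  where
  x = ρ n
  y = ρ m
  0≤n-m : 0ℤ ≤ℤ + n - + m
  0≤n-m = ℤ.i≤j⇒0≤j-i (+≤+ (ℕ.<⇒≤ m<n))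
  split : ∀ N M I J′ X Y → (N + I + 1ℤ) * X * Y - X * ((M + J′ + 1ℤ) * Y) ≡ (N - M) * (X * Y) + (I - J′) * (X * Y)
  split = solve-∀
  difference≡ : (ρshift n · y) (suc J) - (x · ρshift m) (suc J)
    ≡ (+ n - + m) * (x · y) J + sumTo J (λ i → (+ i - + (J ∸ i)) * (x i * y (J ∸ i)))
  difference≡ = begin
      (ρshift n · y) (suc J) - (x · ρshift m) (suc J)
    ≡⟨ cong₂ _-_ (sumTo-head J _)
                 (cong (λ t → sumTo J (λ i → x i * ρshift m (suc J ∸ i)) + x (suc J) * ρshift m t) (ℕ.n∸n≡0 J)) ⟩
      (0ℤ * y (suc J) + sumTo J (λ i → (+ n + + i + 1ℤ) * x i * y (J ∸ i)))
        - (sumTo J (λ i → x i * ρshift m (suc J ∸ i)) + x (suc J) * 0ℤ)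
    ≡⟨ cong₂ _-_ (trans (cong (_+ T₁) (ℤ.*-zeroˡ (y (suc J)))) (ℤ.+-identityˡ T₁))
                 (trans (cong (_+_ T₂) (ℤ.*-zeroʳ (x (suc J))))
                        (trans (ℤ.+-identityʳ T₂)
                               (sumTo-cong J (λ i i≤J → cong (λ t → x i * ρshift m t) (1+n∸m≡1+[n∸m] i≤J))))) ⟩
      sumTo J (λ i → (+ n + + i + 1ℤ) * x i * y (J ∸ i)) - sumTo J (λ i → x i * ((+ m + + (J ∸ i) + 1ℤ) * y (J ∸ i)))
    ≡⟨ sym (sumTo-- J _ _) ⟩
      sumTo J (λ i → (+ n + + i + 1ℤ) * x i * y (J ∸ i) - x i * ((+ m + + (J ∸ i) + 1ℤ) * y (J ∸ i)))
    ≡⟨ sumTo-cong J (λ i _ → split (+ n) (+ m) (+ i) (+ (J ∸ i)) (x i) (y (J ∸ i))) ⟩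
      sumTo J (λ i → (+ n - + m) * (x i * y (J ∸ i)) + (+ i - + (J ∸ i)) * (x i * y (J ∸ i)))
    ≡⟨ trans (sumTo-+ J _ _)
             (cong (_+ sumTo J (λ i → (+ i - + (J ∸ i)) * (x i * y (J ∸ i)))) (sumTo-*ˡ J (+ n - + m) _)) ⟩
      (+ n - + m) * (x · y) J + sumTo J (λ i → (+ i - + (J ∸ i)) * (x i * y (J ∸ i)))
    ∎
    where
    open ≡-Reasoning
    T₁ = sumTo J (λ i → (+ n + + i + 1ℤ) * x i * y (J ∸ i))
    T₂ = sumTo J (λ i → x i * ρshift m (suc J ∸ i))

ρ-·-logConvex : ∀ {m n} → m < n → NonnegCoeffs ((ρ (suc n) · ρ m) − (ρ n · ρ (suc m)))
ρ-·-logConvex {m} {n} m<n J = subst (0ℤ ≤ℤ_) (sym difference≡)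
  (0≤i+j (0≤i*j (ℤ.i≤j⇒0≤j-i (+≤+ (ℕ.<⇒≤ m<n))) (·-nonNeg (ρ n) (ρ m) (ρ-nonNeg n) (ρ-nonNeg m) J))
         (ρshift-·-difference m<n J))
  where
  S = (ρ n · ρ m) J
  distribʳ : ∀ a b c Y → (a * b + c) * Y ≡ a * (b * Y) + c * Y
  distribʳ = solve-∀
  distribˡ : ∀ a b c X → X * (a * b + c) ≡ a * (X * b) + X * c
  distribˡ = solve-∀
  split : ∀ N M S T₁ T₂ → ((N + 1ℤ) * S + T₁) - ((M + 1ℤ) * S + T₂) ≡ (N - M) * S + (T₁ - T₂)
  split = solve-∀
  first : (ρ (suc n) · ρ m) J ≡ (+ n + 1ℤ) * S + (ρshift n · ρ m) J
  first = trans (sumTo-cong J (λ i _ → trans (cong (_* ρ m (J ∸ i)) (ρ-suc n i))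
                                             (distribʳ (+ n + 1ℤ) (ρ n i) (ρshift n i) (ρ m (J ∸ i)))))
                (trans (sumTo-+ J _ _) (cong (_+ (ρshift n · ρ m) J) (sumTo-*ˡ J (+ n + 1ℤ) _)))
  second : (ρ n · ρ (suc m)) J ≡ (+ m + 1ℤ) * S + (ρ n · ρshift m) J
  second = trans (sumTo-cong J (λ i _ → trans (cong (_*_ (ρ n i)) (ρ-suc m (J ∸ i)))
                                              (distribˡ (+ m + 1ℤ) (ρ m (J ∸ i)) (ρshift m (J ∸ i)) (ρ n i))))
                 (trans (sumTo-+ J _ _) (cong (_+ (ρ n · ρshift m) J) (sumTo-*ˡ J (+ m + 1ℤ) _)))
  difference≡ : (ρ (suc n) · ρ m) J - (ρ n · ρ (suc m)) J ≡ (+ n - + m) * S + ((ρshift n · ρ m) J - (ρ n · ρshift m) J)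
  difference≡ = trans (cong₂ _-_ first second) (split (+ n) (+ m) S _ _)

βpoly-stronglyQLogConvex : StronglyQLogConvex (λ n → βpoly (suc n))
βpoly-stronglyQLogConvex n (suc m) _ m<n j = subst (0ℤ ≤ℤ_) (sym difference≡)
  (sumTo-nonNeg N _ (λ u _ → 0≤i*j (ρ-·-logConvex m<n u) (0≤+n ((N ∸ u) C j))))
  where
  N = suc n +ℕ m
  X = ρ (suc n) · ρ m
  Y = ρ n · ρ (suc m)
  product-left : (βpoly (suc (suc n)) · βpoly (suc m)) j ≡ binomialTransform N X j
  product-left = trans (·-cong (βpoly≡binomialTransform (suc n)) (βpoly≡binomialTransform m) j)
    (binomialTransform-· (suc n) m (ρ (suc n)) (ρ m) (ρ-vanish (suc n)) (ρ-vanish m) j)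
  product-right : (βpoly (suc n) · βpoly (suc (suc m))) j ≡ binomialTransform N Y j
  product-right = trans (·-cong (βpoly≡binomialTransform n) (βpoly≡binomialTransform (suc m)) j)
    (trans (binomialTransform-· n (suc m) (ρ n) (ρ (suc m)) (ρ-vanish n) (ρ-vanish (suc m)) j)
           (cong (λ t → binomialTransform t Y j) (ℕ.+-suc n m)))
  difference≡ : (βpoly (suc (suc n)) · βpoly (suc m)) j - (βpoly (suc n) · βpoly (suc (suc m))) j
    ≡ sumTo N (λ u → (X u - Y u) * Cℤ (N ∸ u) j)
  difference≡ = trans (cong₂ _-_ product-left product-right)
    (trans (sym (sumTo-- N _ _)) (sumTo-cong N (λ u _ → sym (distrib (X u) (Y u) (Cℤ (N ∸ u) j)))))
    where distrib : ∀ a b c → (a - b) * c ≡ a * c - b * c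
          distrib = solve-∀

proposition4p1 : (∀ n k → 1 ≤ n → k < n → + 0 <ℤ β n k)
    × (∀ n → 1 ≤ n → LogConcaveRow n (β n))
    × StronglyQLogConvex (λ n → βpoly (suc n))
proposition4p1 = β-pos , rows-logConcave , βpoly-stronglyQLogConvex
  where
  rows-logConcave : ∀ n → 1 ≤ n → LogConcaveRow n (β n)
  rows-logConcave (suc m) _ k _ rewrite ℕ.+-comm k 2 = β-logConcave m k
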